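{- Define integers $a(n)$ by $\sum_{n\ge 0}a(n)q^n=\frac{(q;q)_{\infty}}{(-q;q)_{\infty}}\left( \frac{(q^2;q^2)_{\infty}}{(-q^2;q^2)_{\infty}}\right )^2$. For every positive integer $n$ with $n\equiv 7\pmod 8$, \[ a(n)=2\sigma_0(n)-4\sum_{\substack{r,s,t\ge 1\\(2s-1+r)(2t-1+r)=n+r^2}}(-1)^{r+s+t} = 0, \] where the sum is over positive integers $r,s,t$.
   Context: For $|q|<1$, $(x;q)_\infty=\prod_{k\ge 0}(1-xq^k)$. $\sigma_0(m)$ denotes the number of positive divisors of $m$. -}

module Defs where

open import Data.Nat as ℕ using (ℕ; zero; suc; _∸_; _%_; _/_)
open import Data.Nat.Divisibility using (_∣?_)
open import Data.Integer as ℤ using (ℤ; +_; -_; _*_; _+_; _-_)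
open import Data.List using (List; []; _∷_; map; upTo; filter; length; foldr)
open import Relation.Nullary.Decidable using (does)
open import Data.Bool using (if_then_else_)

Series : Set
Series = ℕ → ℤ

sumTo : ℕ → (ℕ → ℤ) → ℤ
sumTo zero    f = + 0
sumTo (suc n) f = sumTo n f + f n

_⊛_ : Series → Series → Series
(f ⊛ g) n = sumTo (suc n) (λ i → f i * g (n ∸ i))
infixl 7 _⊛_

oneS : Series
oneS zero    = + 1
oneS (suc _) = + 0

sgn : ℕ → ℤ
sgn zero          = + 1
sgn (suc zero)    = - (+ 1)
sgn (suc (suc m)) = sgn m

-- 1 - q^k  (for k ≥ 1, written k = suc m)
oneMinus : ℕ → Series
oneMinus m zero = + 1
oneMinus m (suc n) = if does (suc n ℕ.≟ suc m) then - (+ 1) else + 0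

-- 1/(1 + q^k) = Σ_j (-1)^j q^{kj}   (for k ≥ 1, written k = suc m)
invOnePlus : ℕ → Series
invOnePlus m n = if does (suc m ∣? n) then sgn (n / suc m) else + 0

-- k-th factor (k = suc m):
--   (1-q^k)/(1+q^k) * ((1-q^{2k})/(1+q^{2k}))^2
factor : ℕ → Series
factor m = oneMinus m ⊛ invOnePlus m
         ⊛ oneMinus (suc (2 ℕ.* m)) ⊛ oneMinus (suc (2 ℕ.* m))
         ⊛ invOnePlus (suc (2 ℕ.* m)) ⊛ invOnePlus (suc (2 ℕ.* m))

partialProd : ℕ → Series
partialProd zero    = oneS
partialProd (suc N) = partialProd N ⊛ factor N

-- Factors with k > n are ≡ 1 mod q^{n+1}, so the coefficient of q^n
-- of the infinite product equals that of the product over k = 1..n.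
a : ℕ → ℤ
a n = partialProd n n

σ₀ : ℕ → ℕ
σ₀ n = length (filter (λ d → d ∣? n) (map suc (upTo n)))

sum1 : ℕ → (ℕ → ℤ) → ℤ
sum1 B f = sumTo B (λ i → f (suc i))

-- All solutions satisfy r ≤ n and s, t ≤ n + r^2 (since each factor is
-- ≥ r+1 and the product is n + r^2), so the finite ranges below contain
-- every term of the sum.
tripleSum : ℕ → ℤ
tripleSum n =
  sum1 n λ r → sum1 (n ℕ.+ r ℕ.* r) λ s → sum1 (n ℕ.+ r ℕ.* r) λ t →
    if does ((2 ℕ.* s ∸ 1 ℕ.+ r) ℕ.* (2 ℕ.* t ∸ 1 ℕ.+ r) ℕ.≟ n ℕ.+ r ℕ.* r)
    then sgn (r ℕ.+ s ℕ.+ t) else + 0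

module Submission where

-- Gauss's identity (q;q)∞/(-q;q)∞ = Σ_{j∈ℤ} (-1)^j q^(j²) turns the generating function of a(n) into
-- θ(q) θ(q²)², with θ(q) = Σ_j (-1)^j q^(j²). Its q^n coefficient is a signed count of representations
-- n = x² + 2y² + 2z², which do not exist for n ≡ 7 (mod 8); so a(n) = 0. Gauss's identity is proved
-- modulo q^(N+1) from its finite form Σ_{|j| ≤ N} (-1)^j q^(j²) [2N choose N-j] = (q;q²)_N, by a
-- telescoping recurrence in N.
--
-- Writing y = 2s - 1 and z = 2t - 1, the condition of the triple sum becomes ry + yz + zr = n. For
-- n ≡ 7 (mod 8) the residues mod 8 of this form force the sign of each solution: for even r it is -1,
-- for odd r it is determined by the residues of r, y, z mod 4. Symmetrising over the three variables and
-- a linear change of variables that preserves ry + yz + zr, everything cancels except the solutions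
-- with y = z, i.e. y(y + 2r) = n with r odd. As n ≡ 3 (mod 4) is not a square, these correspond to the
-- factorisations n = d·w with d < w, so the triple sum is σ₀(n)/2.

open import Defs
open import Algebra.Bundles using (CommutativeRing)
open import Data.Nat as ℕ using (ℕ; zero; suc; _∸_; _≤_; _<_; z≤n; s≤s; _%_; _/_)
import Data.Nat.Properties as ℕ
import Data.Integer.Properties as ℤ
open import Relation.Binary.PropositionalEquality as ≡ using (_≡_)
open import Relation.Nullary using (Dec; yes; no; does; ¬_)
open import Function using (id; _∘_)
import Data.Nat.Tactic.RingSolver as ℕ-Ring
import Data.Integer.Tactic.RingSolver as ℤ-Ring


-- Algebra.Solver.Ring needs coefficients with (weakly) decidable equality; ℤ, mapped into R, supplies them
-- for any commutative ring, including the power series below, whose equality is not decidable.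
module IntegerRingSolver {c ℓ} (R : CommutativeRing c ℓ) where

  open CommutativeRing R
  open import Data.Integer as ℤ using (ℤ; +_; -[1+_]; _⊖_)
  open import Data.Sign as Sign using (Sign)
  open import Data.Maybe using (Maybe; just; nothing)
  open import Algebra.Properties.Ring ring using (-‿involutive; -0#≈0#; -‿+-comm; -1*x≈-x)
  open import Algebra.Properties.Semiring.Mult.TCOptimised semiring using (_×_; 1+×; ×-homo-+; ×1-homo-*)
  open import Algebra.Properties.CommutativeSemigroup +-commutativeSemigroup using () renaming (interchange to +-interchange)
  open import Algebra.Properties.CommutativeSemigroup *-commutativeSemigroup using () renaming (interchange to *-interchange)
  open import Relation.Binary.Reasoning.Setoid setoid
  import Algebra.Solver.Ring.AlmostCommutativeRing as ACR

  private
    fromℤ : ℤ → Carrier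
    fromℤ (+ n)    = n × 1#
    fromℤ -[1+ n ] = - (suc n × 1#)

    ⊖-homo : ∀ m n → fromℤ (m ⊖ n) ≈ m × 1# - n × 1#
    ⊖-homo zero    zero    = sym (trans (+-congˡ -0#≈0#) (+-identityʳ _))
    ⊖-homo zero    (suc n) = sym (+-identityˡ _)
    ⊖-homo (suc m) zero    = trans (sym (+-identityʳ _)) (+-congˡ (sym -0#≈0#))
    ⊖-homo (suc m) (suc n) = begin
      fromℤ (suc m ⊖ suc n)             ≡⟨ ≡.cong fromℤ (ℤ.[1+m]⊖[1+n]≡m⊖n m n) ⟩
      fromℤ (m ⊖ n)                     ≈⟨ ⊖-homo m n ⟩
      m × 1# - n × 1#                   ≈⟨ +-identityˡ _ ⟨
      0# + (m × 1# - n × 1#)            ≈⟨ +-congʳ (-‿inverseʳ 1#) ⟨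
      (1# - 1#) + (m × 1# - n × 1#)     ≈⟨ +-interchange 1# _ _ _ ⟩
      (1# + m × 1#) + (- 1# - n × 1#)   ≈⟨ +-cong (1+× m 1#) (trans (-‿cong (1+× n 1#)) (sym (-‿+-comm 1# _))) ⟨
      suc m × 1# - suc n × 1#           ∎

    +-homo : ∀ i j → fromℤ (i ℤ.+ j) ≈ fromℤ i + fromℤ j
    +-homo (+ m)    (+ n)    = ×-homo-+ 1# m n
    +-homo (+ m)    -[1+ n ] = ⊖-homo m (suc n)
    +-homo -[1+ m ] (+ n)    = trans (⊖-homo n (suc m)) (+-comm _ _)
    +-homo -[1+ m ] -[1+ n ] = begin
      - (suc (suc (m ℕ.+ n)) × 1#)      ≡⟨ ≡.cong (λ k → - (k × 1#)) (≡.sym (ℕ.+-suc (suc m) n)) ⟩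
      - ((suc m ℕ.+ suc n) × 1#)        ≈⟨ -‿cong (×-homo-+ 1# (suc m) (suc n)) ⟩
      - (suc m × 1# + suc n × 1#)       ≈⟨ -‿+-comm _ _ ⟨
      - (suc m × 1#) - (suc n × 1#)     ∎

    fromSign : Sign → Carrier
    fromSign Sign.+ = 1#
    fromSign Sign.- = - 1#

    sign-homo : ∀ s t → fromSign (s Sign.* t) ≈ fromSign s * fromSign t
    sign-homo Sign.- Sign.- = sym (trans (-1*x≈-x (- 1#)) (-‿involutive 1#))
    sign-homo Sign.- Sign.+ = sym (*-identityʳ _)
    sign-homo Sign.+ Sign.- = sym (*-identityˡ _)
    sign-homo Sign.+ Sign.+ = sym (*-identityˡ _)

    ◃-homo : ∀ s n → fromℤ (s ℤ.◃ n) ≈ fromSign s * (n × 1#)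
    ◃-homo s      zero    = sym (zeroʳ _)
    ◃-homo Sign.- (suc n) = sym (-1*x≈-x _)
    ◃-homo Sign.+ (suc n) = sym (*-identityˡ _)

    sign-abs : ∀ i → fromℤ i ≈ fromSign (ℤ.sign i) * (ℤ.∣ i ∣ × 1#)
    sign-abs (+ n)    = sym (*-identityˡ _)
    sign-abs -[1+ n ] = sym (-1*x≈-x _)

    *-homo : ∀ i j → fromℤ (i ℤ.* j) ≈ fromℤ i * fromℤ j
    *-homo i j = begin
      fromℤ (i ℤ.* j)                                          ≈⟨ ◃-homo (ℤ.sign i Sign.* ℤ.sign j) (ℤ.∣ i ∣ ℕ.* ℤ.∣ j ∣) ⟩
      fromSign (ℤ.sign i Sign.* ℤ.sign j) * ((ℤ.∣ i ∣ ℕ.* ℤ.∣ j ∣) × 1#)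
                                                               ≈⟨ *-cong (sign-homo (ℤ.sign i) (ℤ.sign j)) (×1-homo-* ℤ.∣ i ∣ ℤ.∣ j ∣) ⟩
      (fromSign (ℤ.sign i) * fromSign (ℤ.sign j)) * ((ℤ.∣ i ∣ × 1#) * (ℤ.∣ j ∣ × 1#))
                                                               ≈⟨ *-interchange _ _ _ _ ⟩
      (fromSign (ℤ.sign i) * (ℤ.∣ i ∣ × 1#)) * (fromSign (ℤ.sign j) * (ℤ.∣ j ∣ × 1#))
                                                               ≈⟨ *-cong (sign-abs i) (sign-abs j) ⟨
      fromℤ i * fromℤ j                                        ∎

    -‿homo : ∀ i → fromℤ (ℤ.- i) ≈ - fromℤ i
    -‿homo (+ zero)  = sym -0#≈0#
    -‿homo (+ suc n) = refl
    -‿homo -[1+ n ]  = sym (-‿involutive _)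

    morphism : ℤ.+-*-rawRing ACR.-Raw-AlmostCommutative⟶ ACR.fromCommutativeRing R
    morphism = record
      { ⟦_⟧    = fromℤ
      ; +-homo = +-homo
      ; *-homo = *-homo
      ; -‿homo = -‿homo
      ; 0-homo = refl
      ; 1-homo = refl
      }

    fromℤ-≟ : ∀ i j → Maybe (fromℤ i ≈ fromℤ j)
    fromℤ-≟ i j with i ℤ.≟ j
    ... | yes i≡j = just (reflexive (≡.cong fromℤ i≡j))
    ... | no  _   = nothing

  open import Algebra.Solver.Ring ℤ.+-*-rawRing (ACR.fromCommutativeRing R) morphism fromℤ-≟ public


module FiniteSums {c ℓ} (R : CommutativeRing c ℓ) where

  open CommutativeRing R
  open IntegerRingSolver R using (solve; _:=_; _:+_; _:-_)
  open import Algebra.Properties.CommutativeSemigroup +-commutativeSemigroup using () renaming (interchange to +-interchange)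

  ∑ : ℕ → (ℕ → Carrier) → Carrier
  ∑ zero    f = 0#
  ∑ (suc n) f = ∑ n f + f n

  ∑-cong : ∀ n {f g : ℕ → Carrier} → (∀ i → i ℕ.< n → f i ≈ g i) → ∑ n f ≈ ∑ n g
  ∑-cong zero    f≈g = refl
  ∑-cong (suc n) f≈g = +-cong (∑-cong n (λ i i<n → f≈g i (ℕ.m<n⇒m<1+n i<n))) (f≈g n ℕ.≤-refl)

  ∑-+ : ∀ n (f g : ℕ → Carrier) → ∑ n (λ i → f i + g i) ≈ ∑ n f + ∑ n g
  ∑-+ zero    f g = sym (+-identityˡ _)
  ∑-+ (suc n) f g = trans (+-congʳ (∑-+ n f g)) (+-interchange (∑ n f) (∑ n g) (f n) (g n))

  ∑-*ˡ : ∀ n w (f : ℕ → Carrier) → ∑ n (λ i → w * f i) ≈ w * ∑ n f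
  ∑-*ˡ zero    w f = sym (zeroʳ _)
  ∑-*ˡ (suc n) w f = trans (+-congʳ (∑-*ˡ n w f)) (sym (distribˡ _ _ _))

  ∑-telescope : ∀ n (h : ℕ → Carrier) → ∑ n (λ i → h (suc i) - h i) ≈ h n - h 0
  ∑-telescope zero    h = sym (-‿inverseʳ _)
  ∑-telescope (suc n) h =
    trans (+-congʳ (∑-telescope n h)) (solve 3 (λ a b c → (a :- c) :+ (b :- a) := b :- c) refl (h n) (h (suc n)) (h 0))


module QBinomial {c ℓ} (R : CommutativeRing c ℓ) (X : CommutativeRing.Carrier R) where

  open CommutativeRing R
  open import Algebra.Properties.Semiring.Exp semiring using (_^_; ^-homo-*; ^-congʳ)
  open import Relation.Binary.Reasoning.Setoid setoid
  open IntegerRingSolver R using (solve; _:=_; _:+_; _:*_; _:-_; con; Polynomial)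
  open import Data.Integer using (+_)

  private
    𝟙 : ∀ {n} → Polynomial n
    𝟙 = con (+ 1)

  -- qBinomial a b is the Gaussian binomial coefficient [a + b choose a] in X.
  qBinomial : ℕ → ℕ → Carrier
  qBinomial zero    b       = 1#
  qBinomial (suc a) zero    = 1#
  qBinomial (suc a) (suc b) = qBinomial a (suc b) + X ^ suc a * qBinomial (suc a) b

  qBinomial-zeroʳ : ∀ a → qBinomial a 0 ≈ 1#
  qBinomial-zeroʳ zero    = refl
  qBinomial-zeroʳ (suc a) = refl

  geometricˡ : ∀ b → (1# - X ^ 1) * qBinomial 1 b ≈ 1# - X ^ suc b
  geometricˡ zero    = *-identityʳ _
  geometricˡ (suc b) = begin
    (1# - X ^ 1) * (1# + X ^ 1 * qBinomial 1 b)
      ≈⟨ solve 2 (λ x g → (𝟙 :- x) :* (𝟙 :+ x :* g) := (𝟙 :- x) :+ x :* ((𝟙 :- x) :* g)) refl (X ^ 1) (qBinomial 1 b) ⟩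
    (1# - X ^ 1) + X ^ 1 * ((1# - X ^ 1) * qBinomial 1 b)
      ≈⟨ +-congˡ (*-congˡ (geometricˡ b)) ⟩
    (1# - X ^ 1) + X ^ 1 * (1# - X ^ suc b)
      ≈⟨ solve 2 (λ x p → (𝟙 :- x :* 𝟙) :+ (x :* 𝟙) :* (𝟙 :- p) := 𝟙 :- x :* p) refl X (X ^ suc b) ⟩
    1# - X ^ suc (suc b) ∎

  geometricʳ : ∀ a → (1# - X ^ 1) * qBinomial a 1 ≈ 1# - X ^ suc a
  geometricʳ zero    = *-identityʳ _
  geometricʳ (suc a) = begin
    (1# - X ^ 1) * (qBinomial a 1 + X ^ suc a * 1#)
      ≈⟨ solve 3 (λ x g p → (𝟙 :- x) :* (g :+ p :* 𝟙) := (𝟙 :- x) :* g :+ (p :- x :* p)) refl (X ^ 1) (qBinomial a 1) (X ^ suc a) ⟩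
    (1# - X ^ 1) * qBinomial a 1 + (X ^ suc a - X ^ 1 * X ^ suc a)
      ≈⟨ +-congʳ (geometricʳ a) ⟩
    (1# - X ^ suc a) + (X ^ suc a - X ^ 1 * X ^ suc a)
      ≈⟨ solve 2 (λ x p → (𝟙 :- p) :+ (p :- (x :* 𝟙) :* p) := 𝟙 :- x :* p) refl X (X ^ suc a) ⟩
    1# - X ^ suc (suc a) ∎

  qBinomial-exchange : ∀ a b → (1# - X ^ suc b) * qBinomial a (suc b) ≈ (1# - X ^ suc a) * qBinomial (suc a) b
  qBinomial-exchange zero    b       = trans (*-identityʳ _) (sym (geometricˡ b))
  qBinomial-exchange (suc a) zero    = trans (geometricʳ (suc a)) (sym (*-identityʳ _))
  qBinomial-exchange (suc a) (suc b) = begin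
    (1# - X * xb) * (g₁ + xa * g₂)
      ≈⟨ solve 5 (λ x xa xb g₁ g₂ → (𝟙 :- x :* xb) :* (g₁ :+ xa :* g₂) := (𝟙 :- x :* xb) :* g₁ :+ (𝟙 :- x :* xb) :* xa :* g₂) refl X xa xb g₁ g₂ ⟩
    (1# - X * xb) * g₁ + (1# - X * xb) * xa * g₂
      ≈⟨ +-congʳ (qBinomial-exchange a (suc b)) ⟩
    (1# - xa) * g₂ + (1# - X * xb) * xa * g₂
      ≈⟨ solve 4 (λ x xa xb g₂ → (𝟙 :- xa) :* g₂ :+ (𝟙 :- x :* xb) :* xa :* g₂ := (𝟙 :- x :* xa) :* g₂ :+ x :* xa :* ((𝟙 :- xb) :* g₂)) refl X xa xb g₂ ⟩
    (1# - X * xa) * g₂ + X * xa * ((1# - xb) * g₂)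
      ≈⟨ +-congˡ (*-congˡ (qBinomial-exchange (suc a) b)) ⟩
    (1# - X * xa) * g₂ + X * xa * ((1# - X * xa) * g₃)
      ≈⟨ solve 4 (λ x xa g₂ g₃ → (𝟙 :- x :* xa) :* g₂ :+ x :* xa :* ((𝟙 :- x :* xa) :* g₃) := (𝟙 :- x :* xa) :* (g₂ :+ x :* xa :* g₃)) refl X xa g₂ g₃ ⟩
    (1# - X * xa) * (g₂ + X * xa * g₃) ∎
    where
    xa xb g₁ g₂ g₃ : Carrier
    xa = X ^ suc a
    xb = X ^ suc b
    g₁ = qBinomial a (suc (suc b))
    g₂ = qBinomial (suc a) (suc b)
    g₃ = qBinomial (suc (suc a)) b

  qBinomial-pascalʳ : ∀ a b → qBinomial (suc a) (suc b) ≈ qBinomial (suc a) b + X ^ suc b * qBinomial a (suc b)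
  qBinomial-pascalʳ a b = begin
    g₁ + xa * g₂
      ≈⟨ solve 4 (λ xb xa g₁ g₂ → g₁ :+ xa :* g₂ := (𝟙 :- xb) :* g₁ :+ xb :* g₁ :+ xa :* g₂) refl xb xa g₁ g₂ ⟩
    (1# - xb) * g₁ + xb * g₁ + xa * g₂
      ≈⟨ +-congʳ (+-congʳ (qBinomial-exchange a b)) ⟩
    (1# - xa) * g₂ + xb * g₁ + xa * g₂
      ≈⟨ solve 4 (λ xb xa g₁ g₂ → (𝟙 :- xa) :* g₂ :+ xb :* g₁ :+ xa :* g₂ := g₂ :+ xb :* g₁) refl xb xa g₁ g₂ ⟩
    g₂ + xb * g₁ ∎
    where
    xa xb g₁ g₂ : Carrier
    xa = X ^ suc a
    xb = X ^ suc b
    g₁ = qBinomial a (suc b)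
    g₂ = qBinomial (suc a) b

  qBinomial-sym : ∀ a b → qBinomial a b ≈ qBinomial b a
  qBinomial-sym zero    zero    = refl
  qBinomial-sym zero    (suc b) = refl
  qBinomial-sym (suc a) zero    = refl
  qBinomial-sym (suc a) (suc b) = begin
    qBinomial a (suc b) + X ^ suc a * qBinomial (suc a) b  ≈⟨ +-cong (qBinomial-sym a (suc b)) (*-congˡ (qBinomial-sym (suc a) b)) ⟩
    qBinomial (suc b) a + X ^ suc a * qBinomial b (suc a)  ≈⟨ qBinomial-pascalʳ b a ⟨
    qBinomial (suc b) (suc a)                              ∎

  qBinomial-absorbˡ : ∀ a b → (1# - X ^ suc a) * qBinomial (suc a) b ≈ (1# - X ^ suc (a ℕ.+ b)) * qBinomial a b
  qBinomial-absorbˡ a zero    =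
    *-cong (+-congˡ (-‿cong (^-congʳ X (≡.cong suc (≡.sym (ℕ.+-identityʳ a)))))) (sym (qBinomial-zeroʳ a))
  qBinomial-absorbˡ a (suc b) = begin
    (1# - xa) * (g₁ + xa * g₂)
      ≈⟨ solve 3 (λ xa g₁ g₂ → (𝟙 :- xa) :* (g₁ :+ xa :* g₂) := (𝟙 :- xa) :* g₁ :+ xa :* ((𝟙 :- xa) :* g₂)) refl xa g₁ g₂ ⟩
    (1# - xa) * g₁ + xa * ((1# - xa) * g₂)
      ≈⟨ +-congˡ (*-congˡ (qBinomial-exchange a b)) ⟨
    (1# - xa) * g₁ + xa * ((1# - xb) * g₁)
      ≈⟨ solve 3 (λ xa xb g₁ → (𝟙 :- xa) :* g₁ :+ xa :* ((𝟙 :- xb) :* g₁) := (𝟙 :- xa :* xb) :* g₁) refl xa xb g₁ ⟩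
    (1# - xa * xb) * g₁
      ≈⟨ *-congʳ (+-congˡ (-‿cong (^-homo-* X (suc a) (suc b)))) ⟨
    (1# - X ^ suc (a ℕ.+ suc b)) * g₁ ∎
    where
    xa xb g₁ g₂ : Carrier
    xa = X ^ suc a
    xb = X ^ suc b
    g₁ = qBinomial a (suc b)
    g₂ = qBinomial (suc a) b

  qBinomial-absorbʳ : ∀ a b → (1# - X ^ suc b) * qBinomial a (suc b) ≈ (1# - X ^ suc (a ℕ.+ b)) * qBinomial a b
  qBinomial-absorbʳ a b = trans (qBinomial-exchange a b) (qBinomial-absorbˡ a b)

  qBinomial-pascal-difference : ∀ a b →
    qBinomial (suc a) (suc b) - (1# - X ^ suc (a ℕ.+ b)) * qBinomial a b
      ≈ X ^ suc a * qBinomial (suc a) b + X ^ suc b * qBinomial a (suc b)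
  qBinomial-pascal-difference a b = begin
    (g₁ + xa * g₂) - (1# - X ^ suc (a ℕ.+ b)) * qBinomial a b
      ≈⟨ +-congˡ (-‿cong (qBinomial-absorbʳ a b)) ⟨
    (g₁ + xa * g₂) - (1# - xb) * g₁
      ≈⟨ solve 4 (λ xa xb g₁ g₂ → (g₁ :+ xa :* g₂) :- (𝟙 :- xb) :* g₁ := xa :* g₂ :+ xb :* g₁) refl xa xb g₁ g₂ ⟩
    xa * g₂ + xb * g₁ ∎
    where
    xa xb g₁ g₂ : Carrier
    xa = X ^ suc a
    xb = X ^ suc b
    g₁ = qBinomial a (suc b)
    g₂ = qBinomial (suc a) b

  qPoch : ℕ → Carrier
  qPoch zero    = 1#
  qPoch (suc m) = qPoch m * (1# - X ^ suc m)

  qPochFrom : ℕ → ℕ → Carrier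
  qPochFrom k zero    = 1#
  qPochFrom k (suc m) = qPochFrom k m * (1# - X ^ suc (k ℕ.+ m))

  qPoch*qBinomial : ∀ k m → qPoch m * qBinomial k m ≈ qPochFrom k m
  qPoch*qBinomial k zero    = trans (*-identityˡ _) (qBinomial-zeroʳ k)
  qPoch*qBinomial k (suc m) = begin
    qPoch m * (1# - X ^ suc m) * qBinomial k (suc m)     ≈⟨ *-assoc _ _ _ ⟩
    qPoch m * ((1# - X ^ suc m) * qBinomial k (suc m))   ≈⟨ *-congˡ (qBinomial-absorbʳ k m) ⟩
    qPoch m * (f * qBinomial k m)                        ≈⟨ solve 3 (λ p f g → p :* (f :* g) := (p :* g) :* f) refl (qPoch m) f (qBinomial k m) ⟩
    qPoch m * qBinomial k m * f                          ≈⟨ *-congʳ (qPoch*qBinomial k m) ⟩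
    qPochFrom k m * f                                    ∎
    where
    f : Carrier
    f = 1# - X ^ suc (k ℕ.+ m)

  qPoch-+ : ∀ n j → qPoch (n ℕ.+ j) ≈ qPoch n * qPochFrom n j
  qPoch-+ n zero    = trans (reflexive (≡.cong qPoch (ℕ.+-identityʳ n))) (sym (*-identityʳ _))
  qPoch-+ n (suc j) = begin
    qPoch (n ℕ.+ suc j)                                  ≡⟨ ≡.cong qPoch (ℕ.+-suc n j) ⟩
    qPoch (n ℕ.+ j) * (1# - X ^ suc (n ℕ.+ j))           ≈⟨ *-congʳ (qPoch-+ n j) ⟩
    qPoch n * qPochFrom n j * (1# - X ^ suc (n ℕ.+ j))   ≈⟨ *-assoc _ _ _ ⟩
    qPoch n * qPochFrom n (suc j)                        ∎


module CongruenceModPower {c ℓ} (R : CommutativeRing c ℓ) (X : CommutativeRing.Carrier R) where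

  open CommutativeRing R
  open import Algebra.Properties.Semiring.Exp semiring using (_^_; ^-homo-*)
  open import Relation.Binary.Reasoning.Setoid setoid
  open IntegerRingSolver R using (solve; _:=_; _:+_; _:*_; :-_; _:-_; con)
  open FiniteSums R using (∑)
  open import Data.Integer using (+_)
  open import Level using (_⊔_)

  infix 4 _≈[X^_]_
  record _≈[X^_]_ (x : Carrier) (e : ℕ) (y : Carrier) : Set (c ⊔ ℓ) where
    constructor divides
    field
      quotient : Carrier
      equality : x - y ≈ X ^ e * quotient

  ≈⇒≈[X^] : ∀ {x y} e → x ≈ y → x ≈[X^ e ] y
  ≈⇒≈[X^] {x} {y} e x≈y = divides 0# (begin
    x - y      ≈⟨ +-congʳ x≈y ⟩
    y - y      ≈⟨ -‿inverseʳ y ⟩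
    0#         ≈⟨ zeroʳ _ ⟨
    X ^ e * 0# ∎)

  ≈[X^]-refl : ∀ {x} e → x ≈[X^ e ] x
  ≈[X^]-refl e = ≈⇒≈[X^] e refl

  ≈[X^]-sym : ∀ {x y e} → x ≈[X^ e ] y → y ≈[X^ e ] x
  ≈[X^]-sym {x} {y} {e} (divides z p) = divides (- z) (begin
    y - x          ≈⟨ solve 2 (λ x y → y :- x := :- (x :- y)) refl x y ⟩
    - (x - y)      ≈⟨ -‿cong p ⟩
    - (X ^ e * z)  ≈⟨ solve 2 (λ a z → :- (a :* z) := a :* (:- z)) refl (X ^ e) z ⟩
    X ^ e * - z    ∎)

  ≈[X^]-trans : ∀ {x y w e} → x ≈[X^ e ] y → y ≈[X^ e ] w → x ≈[X^ e ] w
  ≈[X^]-trans {x} {y} {w} {e} (divides z p) (divides z′ q) = divides (z + z′) (begin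
    x - w                   ≈⟨ solve 3 (λ x y w → x :- w := (x :- y) :+ (y :- w)) refl x y w ⟩
    (x - y) + (y - w)       ≈⟨ +-cong p q ⟩
    X ^ e * z + X ^ e * z′  ≈⟨ distribˡ _ _ _ ⟨
    X ^ e * (z + z′)        ∎)

  ≈[X^]-respʳ : ∀ {x y y′ e} → y ≈ y′ → x ≈[X^ e ] y → x ≈[X^ e ] y′
  ≈[X^]-respʳ y≈y′ (divides z p) = divides z (trans (+-congˡ (-‿cong (sym y≈y′))) p)

  ≈[X^]-respˡ : ∀ {x x′ y e} → x ≈ x′ → x ≈[X^ e ] y → x′ ≈[X^ e ] y
  ≈[X^]-respˡ x≈x′ (divides z p) = divides z (trans (+-congʳ (sym x≈x′)) p)

  ≈[X^]-+ : ∀ {x y u v e} → x ≈[X^ e ] y → u ≈[X^ e ] v → x + u ≈[X^ e ] y + v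
  ≈[X^]-+ {x} {y} {u} {v} {e} (divides z p) (divides z′ q) = divides (z + z′) (begin
    (x + u) - (y + v)       ≈⟨ solve 4 (λ x y u v → (x :+ u) :- (y :+ v) := (x :- y) :+ (u :- v)) refl x y u v ⟩
    (x - y) + (u - v)       ≈⟨ +-cong p q ⟩
    X ^ e * z + X ^ e * z′  ≈⟨ distribˡ _ _ _ ⟨
    X ^ e * (z + z′)        ∎)

  ≈[X^]-* : ∀ {x y u v e} → x ≈[X^ e ] y → u ≈[X^ e ] v → x * u ≈[X^ e ] y * v
  ≈[X^]-* {x} {y} {u} {v} {e} (divides z p) (divides z′ q) = divides (z * u + y * z′) (begin
    x * u - y * v                   ≈⟨ solve 4 (λ x y u v → x :* u :- y :* v := (x :- y) :* u :+ y :* (u :- v)) refl x y u v ⟩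
    (x - y) * u + y * (u - v)       ≈⟨ +-cong (*-congʳ p) (*-congˡ q) ⟩
    X ^ e * z * u + y * (X ^ e * z′) ≈⟨ solve 5 (λ a z u y z′ → a :* z :* u :+ y :* (a :* z′) := a :* (z :* u :+ y :* z′)) refl (X ^ e) z u y z′ ⟩
    X ^ e * (z * u + y * z′)        ∎)

  ≈[X^]-*ˡ : ∀ {x y} w {e} → x ≈[X^ e ] y → w * x ≈[X^ e ] w * y
  ≈[X^]-*ˡ w = ≈[X^]-* (≈[X^]-refl _)

  ≈[X^]-*ʳ : ∀ {x y} w {e} → x ≈[X^ e ] y → x * w ≈[X^ e ] y * w
  ≈[X^]-*ʳ w p = ≈[X^]-* p (≈[X^]-refl _)

  ≈[X^]-weaken : ∀ {x y e d} → d ℕ.≤ e → x ≈[X^ e ] y → x ≈[X^ d ] y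
  ≈[X^]-weaken {x} {y} {e} {d} d≤e (divides z p) = divides (X ^ (e ∸ d) * z) (begin
    x - y                        ≈⟨ p ⟩
    X ^ e * z                    ≡⟨ ≡.cong (λ k → X ^ k * z) (≡.sym (ℕ.m+[n∸m]≡n d≤e)) ⟩
    X ^ (d ℕ.+ (e ∸ d)) * z      ≈⟨ *-congʳ (^-homo-* X d (e ∸ d)) ⟩
    X ^ d * X ^ (e ∸ d) * z      ≈⟨ *-assoc _ _ _ ⟩
    X ^ d * (X ^ (e ∸ d) * z)    ∎)

  ≈[X^]-X^ : ∀ {x y} a e → x ≈[X^ e ] y → X ^ a * x ≈[X^ a ℕ.+ e ] X ^ a * y
  ≈[X^]-X^ {x} {y} a e (divides z p) = divides z (begin
    X ^ a * x - X ^ a * y        ≈⟨ solve 3 (λ a x y → a :* x :- a :* y := a :* (x :- y)) refl (X ^ a) x y ⟩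
    X ^ a * (x - y)              ≈⟨ *-congˡ p ⟩
    X ^ a * (X ^ e * z)          ≈⟨ *-assoc _ _ _ ⟨
    X ^ a * X ^ e * z            ≈⟨ *-congʳ (^-homo-* X a e) ⟨
    X ^ (a ℕ.+ e) * z            ∎)

  1-X^[k+m]≈1 : ∀ k m → 1# - X ^ (k ℕ.+ m) ≈[X^ k ] 1#
  1-X^[k+m]≈1 k m = divides (- X ^ m) (begin
    (1# - X ^ (k ℕ.+ m)) - 1#    ≈⟨ +-congʳ (+-congˡ (-‿cong (^-homo-* X k m))) ⟩
    (1# - X ^ k * X ^ m) - 1#    ≈⟨ solve 2 (λ a b → (con (+ 1) :- a :* b) :- con (+ 1) := a :* (:- b)) refl (X ^ k) (X ^ m) ⟩
    X ^ k * - X ^ m              ∎)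

  ∑-≈[X^] : ∀ n e {f g : ℕ → Carrier} → (∀ i → i ℕ.< n → f i ≈[X^ e ] g i) → ∑ n f ≈[X^ e ] ∑ n g
  ∑-≈[X^] zero    e f≈g = ≈[X^]-refl e
  ∑-≈[X^] (suc n) e f≈g = ≈[X^]-+ (∑-≈[X^] n e (λ i i<n → f≈g i (ℕ.m<n⇒m<1+n i<n))) (f≈g n ℕ.≤-refl)


module GaussIdentity {c ℓ} (R : CommutativeRing c ℓ) (X : CommutativeRing.Carrier R) where

  open CommutativeRing R
  open import Algebra.Properties.Semiring.Exp semiring using (_^_; ^-homo-*)
  open import Relation.Binary.Reasoning.Setoid setoid
  open IntegerRingSolver R using (solve; _:=_; _:+_; _:*_; :-_; _:-_; con; Polynomial)
  open FiniteSums R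
  open QBinomial R X
  open CongruenceModPower R X
  open import Data.Integer using (+_)

  private
    𝟙 : ∀ {n} → Polynomial n
    𝟙 = con (+ 1)

    move : ∀ {x y z} → x - y ≈ z → x ≈ y + z
    move {x} {y} {z} x-y≈z = begin
      x            ≈⟨ solve 2 (λ x y → x := y :+ (x :- y)) refl x y ⟩
      y + (x - y)  ≈⟨ +-congˡ x-y≈z ⟩
      y + z        ∎

  -- gaussSum N is Σ_{|j| ≤ N} (-1)^j X^(j²) [2N choose N - j], with the terms for j and -j merged.
  gaussTerm : ℕ → ℕ → Carrier
  gaussTerm N j = (- 1#) ^ j * X ^ (j ℕ.* j) * qBinomial (N ℕ.+ j) (N ∸ j)

  gaussTail : ℕ → Carrier
  gaussTail N = ∑ N (λ i → gaussTerm N (suc i))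

  gaussSum : ℕ → Carrier
  gaussSum N = qBinomial N N + (gaussTail N + gaussTail N)

  oddFactor : ℕ → Carrier
  oddFactor N = 1# - X ^ suc (N ℕ.+ N)

  oddPoch : ℕ → Carrier
  oddPoch zero    = 1#
  oddPoch (suc N) = oddPoch N * oddFactor N

  -- The summands of gaussSum (suc N) - oddFactor N * gaussSum N telescope with this certificate.
  certificate : ℕ → ℕ → Carrier
  certificate N j = (- 1#) ^ j * X ^ (j ℕ.* j) * (X ^ suc (N ℕ.+ j) * qBinomial (suc (N ℕ.+ j)) (N ∸ j))

  certificate-pred : ∀ i m → let N = suc i ℕ.+ m in
    certificate N i ≈ (- 1#) ^ i * (X ^ (suc i ℕ.* suc i) * X ^ suc m) * qBinomial (N ℕ.+ suc i) (suc m)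
  certificate-pred i m = begin
    s * X ^ (i ℕ.* i) * (X ^ suc (N ℕ.+ i) * qBinomial (suc (N ℕ.+ i)) (N ∸ i))
      ≈⟨ solve 4 (λ s p q r → s :* p :* (q :* r) := s :* (p :* q) :* r) refl s (X ^ (i ℕ.* i)) (X ^ suc (N ℕ.+ i)) _ ⟩
    s * (X ^ (i ℕ.* i) * X ^ suc (N ℕ.+ i)) * qBinomial (suc (N ℕ.+ i)) (N ∸ i)
      ≈⟨ *-congʳ (*-congˡ (^-homo-* X (i ℕ.* i) _)) ⟨
    s * X ^ (i ℕ.* i ℕ.+ suc (N ℕ.+ i)) * qBinomial (suc (N ℕ.+ i)) (N ∸ i)
      ≡⟨ ≡.cong₂ (λ k l → s * X ^ k * qBinomial l (N ∸ i)) (exponent i m) (≡.sym (ℕ.+-suc N i)) ⟩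
    s * X ^ (suc i ℕ.* suc i ℕ.+ suc m) * qBinomial (N ℕ.+ suc i) (N ∸ i)
      ≈⟨ *-cong (*-congˡ (^-homo-* X (suc i ℕ.* suc i) (suc m))) (reflexive (≡.cong (qBinomial (N ℕ.+ suc i)) N∸i)) ⟩
    s * (X ^ (suc i ℕ.* suc i) * X ^ suc m) * qBinomial (N ℕ.+ suc i) (suc m) ∎
    where
    N : ℕ
    N = suc i ℕ.+ m
    s : Carrier
    s = (- 1#) ^ i
    exponent : ∀ i m → i ℕ.* i ℕ.+ suc (suc i ℕ.+ m ℕ.+ i) ≡ suc i ℕ.* suc i ℕ.+ suc m
    exponent = ℕ-Ring.solve-∀
    N∸i : N ∸ i ≡ suc m
    N∸i = ≡.trans (≡.cong (_∸ i) (≡.sym (ℕ.+-suc i m))) (ℕ.m+n∸m≡n i (suc m))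

  gaussTerm-step : ∀ i m → let N = suc i ℕ.+ m in
    gaussTerm (suc N) (suc i) - oddFactor N * gaussTerm N (suc i) ≈ certificate N (suc i) - certificate N i
  gaussTerm-step i m = begin
    gaussTerm (suc N) j - oddFactor N * gaussTerm N j
      ≡⟨ ≡.cong₂ (λ u v → s * xj * qBinomial (suc M) u - (1# - X ^ suc v) * (s * xj * qBinomial M (N ∸ j))) N∸i N+N≡M+m ⟩
    s * xj * qBinomial (suc M) (suc m) - f * (s * xj * qBinomial M (N ∸ j))
      ≡⟨ ≡.cong (λ u → s * xj * qBinomial (suc M) (suc m) - f * (s * xj * qBinomial M u)) N∸j ⟩
    s * xj * qBinomial (suc M) (suc m) - f * (s * xj * qBinomial M m)
      ≈⟨ solve 5 (λ s xj g₁ f g₀ → s :* xj :* g₁ :- f :* (s :* xj :* g₀) := s :* xj :* (g₁ :- f :* g₀)) refl s xj _ f _ ⟩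
    s * xj * (qBinomial (suc M) (suc m) - f * qBinomial M m)
      ≈⟨ *-congˡ (qBinomial-pascal-difference M m) ⟩
    s * xj * (X ^ suc M * qBinomial (suc M) m + X ^ suc m * qBinomial M (suc m))
      ≈⟨ solve 6 (λ s′ xj xM xm u v → (:- 𝟙 :* s′) :* xj :* (xM :* u :+ xm :* v)
                                     := (:- 𝟙 :* s′) :* xj :* (xM :* u) :- s′ :* (xj :* xm) :* v)
               refl s′ xj (X ^ suc M) (X ^ suc m) (qBinomial (suc M) m) (qBinomial M (suc m)) ⟩
    s * xj * (X ^ suc M * qBinomial (suc M) m) - s′ * (xj * X ^ suc m) * qBinomial M (suc m)
      ≈⟨ +-cong (reflexive (≡.cong (λ k → s * xj * (X ^ suc M * qBinomial (suc M) k)) N∸j)) (-‿cong (certificate-pred i m)) ⟨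
    certificate N j - certificate N i ∎
    where
    N j M : ℕ
    N = suc i ℕ.+ m
    j = suc i
    M = N ℕ.+ j
    s s′ xj f : Carrier
    s = (- 1#) ^ j
    s′ = (- 1#) ^ i
    xj = X ^ (j ℕ.* j)
    f = 1# - X ^ suc (M ℕ.+ m)
    N∸i : N ∸ i ≡ suc m
    N∸i = ≡.trans (≡.cong (_∸ i) (≡.sym (ℕ.+-suc i m))) (ℕ.m+n∸m≡n i (suc m))
    N∸j : N ∸ j ≡ m
    N∸j = ℕ.m+n∸m≡n j m
    N+N≡M+m : N ℕ.+ N ≡ M ℕ.+ m
    N+N≡M+m = rearrange i m
      where
      rearrange : ∀ i m → suc i ℕ.+ m ℕ.+ (suc i ℕ.+ m) ≡ suc i ℕ.+ m ℕ.+ suc i ℕ.+ m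
      rearrange = ℕ-Ring.solve-∀

  gaussTail-step : ∀ N → ∑ N (λ i → gaussTerm (suc N) (suc i)) ≈ oddFactor N * gaussTail N + (certificate N N - certificate N 0)
  gaussTail-step N = begin
    ∑ N (λ i → gaussTerm (suc N) (suc i))
      ≈⟨ ∑-cong N step ⟩
    ∑ N (λ i → oddFactor N * gaussTerm N (suc i) + (certificate N (suc i) - certificate N i))
      ≈⟨ ∑-+ N _ _ ⟩
    ∑ N (λ i → oddFactor N * gaussTerm N (suc i)) + ∑ N (λ i → certificate N (suc i) - certificate N i)
      ≈⟨ +-cong (∑-*ˡ N (oddFactor N) _) (∑-telescope N (certificate N)) ⟩
    oddFactor N * gaussTail N + (certificate N N - certificate N 0) ∎
    where
    Step : ℕ → ℕ → Set _
    Step K i = gaussTerm (suc K) (suc i) ≈ oddFactor K * gaussTerm K (suc i) + (certificate K (suc i) - certificate K i)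
    step : ∀ i → i ℕ.< N → Step N i
    step i i<N = ≡.subst (λ K → Step K i) (ℕ.m+[n∸m]≡n i<N) (move (gaussTerm-step i (N ∸ suc i)))

  certificate-last : ∀ N → certificate N N + gaussTerm (suc N) (suc N) ≈ 0#
  certificate-last N = begin
    s * x * (y * G₁ (N ∸ N)) + (- 1# * s) * X ^ (suc N ℕ.* suc N) * G₂ (N ∸ N)
      ≡⟨ ≡.cong (λ k → s * x * (y * G₁ k) + (- 1# * s) * X ^ (suc N ℕ.* suc N) * G₂ k) (ℕ.n∸n≡0 N) ⟩
    s * x * (y * G₁ 0) + (- 1# * s) * X ^ (suc N ℕ.* suc N) * G₂ 0
      ≈⟨ +-cong (*-congˡ (*-congˡ (qBinomial-zeroʳ (suc (N ℕ.+ N))))) (*-cong (*-congˡ square) (qBinomial-zeroʳ (suc N ℕ.+ suc N))) ⟩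
    s * x * (y * 1#) + (- 1# * s) * (x * y) * 1#
      ≈⟨ solve 3 (λ s x y → s :* x :* (y :* 𝟙) :+ (:- 𝟙 :* s) :* (x :* y) :* 𝟙 := con (+ 0)) refl s x y ⟩
    0# ∎
    where
    s x y : Carrier
    s = (- 1#) ^ N
    x = X ^ (N ℕ.* N)
    y = X ^ suc (N ℕ.+ N)
    G₁ G₂ : ℕ → Carrier
    G₁ = qBinomial (suc (N ℕ.+ N))
    G₂ = qBinomial (suc N ℕ.+ suc N)
    expand : ∀ n → suc n ℕ.* suc n ≡ n ℕ.* n ℕ.+ suc (n ℕ.+ n)
    expand = ℕ-Ring.solve-∀
    square : X ^ (suc N ℕ.* suc N) ≈ x * y
    square = trans (reflexive (≡.cong (X ^_) (expand N))) (^-homo-* X (N ℕ.* N) _)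

  gaussHead-step : ∀ N → qBinomial (suc N) (suc N) ≈ oddFactor N * qBinomial N N + (certificate N 0 + certificate N 0)
  gaussHead-step N = move (begin
    qBinomial (suc N) (suc N) - oddFactor N * qBinomial N N ≈⟨ qBinomial-pascal-difference N N ⟩
    x * qBinomial (suc N) N + x * qBinomial N (suc N)      ≈⟨ +-congˡ (*-congˡ (qBinomial-sym N (suc N))) ⟩
    x * qBinomial (suc N) N + x * qBinomial (suc N) N      ≈⟨ +-cong certificate-0 certificate-0 ⟨
    certificate N 0 + certificate N 0                      ∎)
    where
    x : Carrier
    x = X ^ suc N
    certificate-0 : certificate N 0 ≈ x * qBinomial (suc N) N
    certificate-0 = begin
      1# * 1# * (X ^ suc (N ℕ.+ 0) * qBinomial (suc (N ℕ.+ 0)) N)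
        ≡⟨ ≡.cong (λ k → 1# * 1# * (X ^ suc k * qBinomial (suc k) N)) (ℕ.+-identityʳ N) ⟩
      1# * 1# * (x * qBinomial (suc N) N)
        ≈⟨ trans (*-congʳ (*-identityˡ _)) (*-identityˡ _) ⟩
      x * qBinomial (suc N) N ∎

  gaussSum-step : ∀ N → gaussSum (suc N) ≈ oddFactor N * gaussSum N
  gaussSum-step N = begin
    qBinomial (suc N) (suc N) + (tail′ + tail′)
      ≈⟨ +-cong (gaussHead-step N) (+-cong tail-step tail-step) ⟩
    (f * B + (w + w)) + ((f * T + (u - w) + v) + (f * T + (u - w) + v))
      ≈⟨ solve 6 (λ f b t u v w → (f :* b :+ (w :+ w)) :+ ((f :* t :+ (u :- w) :+ v) :+ (f :* t :+ (u :- w) :+ v))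
                                 := f :* (b :+ (t :+ t)) :+ ((u :+ v) :+ (u :+ v))) refl f B T u v w ⟩
    f * (B + (T + T)) + ((u + v) + (u + v))
      ≈⟨ +-congˡ (+-cong (certificate-last N) (certificate-last N)) ⟩
    f * (B + (T + T)) + (0# + 0#)
      ≈⟨ trans (+-congˡ (+-identityˡ _)) (+-identityʳ _) ⟩
    f * (B + (T + T)) ∎
    where
    tail′ f B T u w v : Carrier
    tail′ = gaussTail (suc N)
    f = oddFactor N
    B = qBinomial N N
    T = gaussTail N
    u = certificate N N
    w = certificate N 0
    v = gaussTerm (suc N) (suc N)
    tail-step : tail′ ≈ f * T + (u - w) + v
    tail-step = +-congʳ (gaussTail-step N)

  gaussSum≈oddPoch : ∀ N → gaussSum N ≈ oddPoch N
  gaussSum≈oddPoch zero    = trans (+-congˡ (+-identityˡ _)) (+-identityʳ _)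
  gaussSum≈oddPoch (suc N) = trans (gaussSum-step N) (trans (*-congˡ (gaussSum≈oddPoch N)) (*-comm _ _))

  thetaTail : ℕ → Carrier
  thetaTail N = ∑ N (λ i → (- 1#) ^ suc i * X ^ (suc i ℕ.* suc i))

  theta : ℕ → Carrier
  theta N = 1# + (thetaTail N + thetaTail N)

  qPochFrom≈1 : ∀ k m → qPochFrom k m ≈[X^ suc k ] 1#
  qPochFrom≈1 k zero    = ≈[X^]-refl (suc k)
  qPochFrom≈1 k (suc m) = ≈[X^]-respʳ (*-identityˡ 1#) (≈[X^]-* (qPochFrom≈1 k m) (1-X^[k+m]≈1 (suc k) m))

  qPoch*gaussTerm : ∀ i m → let N = suc i ℕ.+ m in
    qPoch N * gaussTerm N (suc i) ≈[X^ suc N ] (- 1#) ^ suc i * X ^ (suc i ℕ.* suc i)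
  qPoch*gaussTerm i m =
    ≈[X^]-respˡ rearranged (≈[X^]-respʳ (*-congˡ (*-identityʳ _))
      (≈[X^]-weaken N<j²+m (≈[X^]-*ˡ s (≈[X^]-X^ (j ℕ.* j) (suc m) products≈1))))
    where
    N j : ℕ
    N = suc i ℕ.+ m
    j = suc i
    s xj : Carrier
    s = (- 1#) ^ j
    xj = X ^ (j ℕ.* j)
    products≈1 : qPochFrom (N ℕ.+ j) m * qPochFrom m j ≈[X^ suc m ] 1#
    products≈1 = ≈[X^]-respʳ (*-identityˡ 1#)
      (≈[X^]-* (≈[X^]-weaken (ℕ.s≤s (ℕ.≤-trans (ℕ.m≤n+m m j) (ℕ.m≤m+n N j))) (qPochFrom≈1 (N ℕ.+ j) m)) (qPochFrom≈1 m j))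
    rearranged : s * (xj * (qPochFrom (N ℕ.+ j) m * qPochFrom m j)) ≈ qPoch N * gaussTerm N j
    rearranged = begin
      s * (xj * (qPochFrom (N ℕ.+ j) m * qPochFrom m j))        ≈⟨ *-congˡ (*-congˡ (*-congʳ (qPoch*qBinomial (N ℕ.+ j) m))) ⟨
      s * (xj * (qPoch m * qBinomial (N ℕ.+ j) m * qPochFrom m j))
        ≈⟨ solve 5 (λ s x p g q → s :* (x :* (p :* g :* q)) := (p :* q) :* (s :* x :* g)) refl s xj (qPoch m) (qBinomial (N ℕ.+ j) m) (qPochFrom m j) ⟩
      (qPoch m * qPochFrom m j) * (s * xj * qBinomial (N ℕ.+ j) m)
        ≈⟨ *-cong (qPoch-+ m j) (reflexive (≡.cong (λ k → s * xj * qBinomial (N ℕ.+ j) k) (ℕ.m+n∸m≡n j m))) ⟨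
      qPoch (m ℕ.+ j) * gaussTerm N j                           ≡⟨ ≡.cong (λ k → qPoch k * gaussTerm N j) (ℕ.+-comm m j) ⟩
      qPoch N * gaussTerm N j                                   ∎
    N<j²+m : suc N ℕ.≤ j ℕ.* j ℕ.+ suc m
    N<j²+m = ≡.subst (ℕ._≤ j ℕ.* j ℕ.+ suc m) (ℕ.+-suc j m) (ℕ.+-monoˡ-≤ (suc m) (ℕ.m≤m*n j j))

  qPoch*gaussSum : ∀ N → qPoch N * gaussSum N ≈[X^ suc N ] theta N
  qPoch*gaussSum N =
    ≈[X^]-respˡ (sym distributed)
      (≈[X^]-+ (≈[X^]-respˡ (sym (qPoch*qBinomial N N)) (qPochFrom≈1 N N)) (≈[X^]-+ tail≈ tail≈))
    where
    tail≈ : ∑ N (λ i → qPoch N * gaussTerm N (suc i)) ≈[X^ suc N ] thetaTail N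
    tail≈ = ∑-≈[X^] N (suc N) (λ i i<N →
      ≡.subst (λ K → qPoch K * gaussTerm K (suc i) ≈[X^ suc K ] (- 1#) ^ suc i * X ^ (suc i ℕ.* suc i))
        (ℕ.m+[n∸m]≡n i<N) (qPoch*gaussTerm i (N ∸ suc i)))
    distributed : qPoch N * gaussSum N ≈
                  qPoch N * qBinomial N N + (∑ N (λ i → qPoch N * gaussTerm N (suc i)) + ∑ N (λ i → qPoch N * gaussTerm N (suc i)))
    distributed = trans (distribˡ _ _ _) (+-congˡ (trans (distribˡ _ _ _) (sym (+-cong (∑-*ˡ N (qPoch N) _) (∑-*ˡ N (qPoch N) _)))))

  negPoch : ℕ → Carrier
  negPoch zero    = 1#
  negPoch (suc N) = negPoch N * (1# + X ^ suc N)

  evenPoch : ℕ → Carrier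
  evenPoch zero    = 1#
  evenPoch (suc N) = evenPoch N * (1# - X ^ suc N * X ^ suc N)

  qPoch*negPoch : ∀ N → qPoch N * negPoch N ≈ evenPoch N
  qPoch*negPoch zero    = *-identityˡ _
  qPoch*negPoch (suc N) = begin
    qPoch N * (1# - x) * (negPoch N * (1# + x)) ≈⟨ solve 3 (λ p x n → p :* (𝟙 :- x) :* (n :* (𝟙 :+ x))
                                                             := p :* n :* (𝟙 :- x :* x)) refl (qPoch N) x (negPoch N) ⟩
    qPoch N * negPoch N * (1# - x * x)          ≈⟨ *-congʳ (qPoch*negPoch N) ⟩
    evenPoch N * (1# - x * x)                   ∎
    where
    x : Carrier
    x = X ^ suc N

  oddPoch*evenPoch : ∀ N → oddPoch N * evenPoch N ≈ qPoch (N ℕ.+ N)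
  oddPoch*evenPoch zero    = *-identityˡ _
  oddPoch*evenPoch (suc N) = begin
    oddPoch N * oddFactor N * (evenPoch N * (1# - x * x))
      ≈⟨ solve 4 (λ o f e y → o :* f :* (e :* y) := o :* e :* f :* y) refl (oddPoch N) (oddFactor N) (evenPoch N) (1# - x * x) ⟩
    oddPoch N * evenPoch N * oddFactor N * (1# - x * x)
      ≈⟨ *-cong (*-congʳ (sym (oddPoch*evenPoch N))) (+-congˡ (-‿cong (^-homo-* X (suc N) (suc N)))) ⟨
    qPoch (N ℕ.+ N) * oddFactor N * (1# - X ^ (suc N ℕ.+ suc N))
      ≡⟨ ≡.cong (λ k → qPoch (N ℕ.+ N) * oddFactor N * (1# - X ^ suc k)) (ℕ.+-suc N N) ⟩
    qPoch (suc (suc (N ℕ.+ N)))                                  ≡⟨ ≡.cong (qPoch ∘ suc) (ℕ.+-suc N N) ⟨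
    qPoch (suc N ℕ.+ suc N)                                      ∎
    where
    x : Carrier
    x = X ^ suc N

  qPoch-double : ∀ N → qPoch (N ℕ.+ N) ≈[X^ suc N ] qPoch N
  qPoch-double N = ≈[X^]-respˡ (sym (qPoch-+ N N)) (≈[X^]-respʳ (*-identityʳ _) (≈[X^]-*ˡ (qPoch N) (qPochFrom≈1 N N)))

  module _ (V : ℕ → Carrier) (V-inverse : ∀ k → (1# + X ^ suc k) * V k ≈ 1#) where

    quotientPoch : ℕ → Carrier
    quotientPoch zero    = 1#
    quotientPoch (suc N) = quotientPoch N * ((1# - X ^ suc N) * V N)

    private
      ∏V : ℕ → Carrier
      ∏V zero    = 1#
      ∏V (suc N) = ∏V N * V N

      quotientPoch≈ : ∀ N → quotientPoch N ≈ qPoch N * ∏V N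
      quotientPoch≈ zero    = sym (*-identityˡ _)
      quotientPoch≈ (suc N) = trans (*-congʳ (quotientPoch≈ N))
        (solve 4 (λ p w a v → p :* w :* (a :* v) := p :* a :* (w :* v)) refl (qPoch N) (∏V N) (1# - X ^ suc N) (V N))

      negPoch*∏V : ∀ N → negPoch N * ∏V N ≈ 1#
      negPoch*∏V zero    = *-identityˡ _
      negPoch*∏V (suc N) = begin
        negPoch N * (1# + X ^ suc N) * (∏V N * V N)
          ≈⟨ solve 4 (λ n a w v → n :* a :* (w :* v) := (n :* w) :* (a :* v)) refl (negPoch N) (1# + X ^ suc N) (∏V N) (V N) ⟩
        (negPoch N * ∏V N) * ((1# + X ^ suc N) * V N) ≈⟨ *-cong (negPoch*∏V N) (V-inverse N) ⟩
        1# * 1#                                        ≈⟨ *-identityˡ _ ⟩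
        1#                                             ∎

    -- negPoch · ∏V = 1, θ ≡ qPoch · gaussSum = qPoch · oddPoch, and qPoch · oddPoch · negPoch = qPoch (2N) ≡ qPoch.
    gauss : ∀ N → quotientPoch N ≈[X^ suc N ] theta N
    gauss N = ≈[X^]-sym (≈[X^]-respˡ θ·1≈θ (≈[X^]-respʳ (sym (quotientPoch≈ N)) (≈[X^]-trans truncate shorten)))
      where
      θ·1≈θ : theta N * (negPoch N * ∏V N) ≈ theta N
      θ·1≈θ = trans (*-congˡ (negPoch*∏V N)) (*-identityʳ _)
      collapse : qPoch N * gaussSum N * (negPoch N * ∏V N) ≈ qPoch (N ℕ.+ N) * ∏V N
      collapse = begin
        qPoch N * gaussSum N * (negPoch N * ∏V N) ≈⟨ *-congʳ (*-congˡ (gaussSum≈oddPoch N)) ⟩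
        qPoch N * oddPoch N * (negPoch N * ∏V N)
          ≈⟨ solve 4 (λ p o n w → p :* o :* (n :* w) := o :* (p :* n) :* w) refl (qPoch N) (oddPoch N) (negPoch N) (∏V N) ⟩
        oddPoch N * (qPoch N * negPoch N) * ∏V N  ≈⟨ *-congʳ (*-congˡ (qPoch*negPoch N)) ⟩
        oddPoch N * evenPoch N * ∏V N             ≈⟨ *-congʳ (oddPoch*evenPoch N) ⟩
        qPoch (N ℕ.+ N) * ∏V N                    ∎
      truncate : theta N * (negPoch N * ∏V N) ≈[X^ suc N ] qPoch (N ℕ.+ N) * ∏V N
      truncate = ≈[X^]-respʳ collapse (≈[X^]-*ʳ (negPoch N * ∏V N) (≈[X^]-sym (qPoch*gaussSum N)))
      shorten : qPoch (N ℕ.+ N) * ∏V N ≈[X^ suc N ] qPoch N * ∏V N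
      shorten = ≈[X^]-*ʳ (∏V N) (qPoch-double N)


module FactorRegrouping {c ℓ} (R : CommutativeRing c ℓ) where

  open CommutativeRing R
  open IntegerRingSolver R using (solve; _:=_; _:*_)

  product-step : ∀ P h₁ h₂ α α′ b γ γ′ d → P ≈ h₁ * h₂ * h₂ → α ≈ α′ → γ ≈ γ′ →
    P * (α * b * γ * γ * d * d) ≈ h₁ * (α′ * b) * (h₂ * (γ′ * d)) * (h₂ * (γ′ * d))
  product-step P h₁ h₂ α α′ b γ γ′ d P≈ α≈α′ γ≈γ′ =
    trans (*-cong P≈ (*-congʳ {d} (*-congʳ {d} (*-cong (*-cong (*-congʳ {b} α≈α′) γ≈γ′) γ≈γ′))))
          (solve 6 (λ h₁ h₂ a b c d → (h₁ :* h₂ :* h₂) :* (a :* b :* c :* c :* d :* d)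
                                     := h₁ :* (a :* b) :* (h₂ :* (c :* d)) :* (h₂ :* (c :* d))) refl h₁ h₂ α′ b γ′ d)


module IntegerSums where

  open import Data.Integer using (ℤ; +_; -_; _*_; _+_)
  open import Data.Bool using (Bool; if_then_else_)
  open import Data.Sum using (inj₁; inj₂)
  open import Relation.Nullary.Decidable using (dec-true; dec-false)
  open import Relation.Binary.Definitions using (tri<; tri≈; tri>)
  open ≡ using (_≢_; refl; cong; cong₂; sym; trans)
  open ≡.≡-Reasoning
  open import Algebra.Properties.CommutativeSemigroup ℤ.+-commutativeSemigroup using (interchange)

  sumTo-cong : ∀ n {f g : ℕ → ℤ} → (∀ i → i < n → f i ≡ g i) → sumTo n f ≡ sumTo n g
  sumTo-cong zero    f≡g = refl
  sumTo-cong (suc n) f≡g = cong₂ _+_ (sumTo-cong n (λ i i<n → f≡g i (ℕ.m<n⇒m<1+n i<n))) (f≡g n ℕ.≤-refl)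

  sumTo-≡0 : ∀ n {f : ℕ → ℤ} → (∀ i → i < n → f i ≡ + 0) → sumTo n f ≡ + 0
  sumTo-≡0 zero    f≡0 = refl
  sumTo-≡0 (suc n) f≡0 = cong₂ _+_ (sumTo-≡0 n (λ i i<n → f≡0 i (ℕ.m<n⇒m<1+n i<n))) (f≡0 n ℕ.≤-refl)

  sumTo-+ : ∀ n (f g : ℕ → ℤ) → sumTo n (λ i → f i + g i) ≡ sumTo n f + sumTo n g
  sumTo-+ zero    f g = refl
  sumTo-+ (suc n) f g = trans (cong (_+ (f n + g n)) (sumTo-+ n f g)) (interchange (sumTo n f) (sumTo n g) (f n) (g n))

  sumTo-neg : ∀ n (f : ℕ → ℤ) → sumTo n (λ i → - f i) ≡ - sumTo n f
  sumTo-neg zero    f = refl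
  sumTo-neg (suc n) f = trans (cong (_+ - f n) (sumTo-neg n f)) (sym (ℤ.neg-distrib-+ (sumTo n f) (f n)))

  sumTo-*ˡ : ∀ n c (f : ℕ → ℤ) → sumTo n (λ i → c * f i) ≡ c * sumTo n f
  sumTo-*ˡ zero    c f = sym (ℤ.*-zeroʳ c)
  sumTo-*ˡ (suc n) c f = trans (cong (_+ (c * f n)) (sumTo-*ˡ n c f)) (sym (ℤ.*-distribˡ-+ c _ _))

  sumTo-*ʳ : ∀ n c (f : ℕ → ℤ) → sumTo n (λ i → f i * c) ≡ sumTo n f * c
  sumTo-*ʳ n c f = trans (sumTo-cong n (λ i _ → ℤ.*-comm (f i) c)) (trans (sumTo-*ˡ n c f) (ℤ.*-comm c _))

  sumTo-unfoldˡ : ∀ n (f : ℕ → ℤ) → sumTo (suc n) f ≡ f 0 + sumTo n (λ i → f (suc i))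
  sumTo-unfoldˡ zero    f = trans (ℤ.+-identityˡ (f 0)) (sym (ℤ.+-identityʳ (f 0)))
  sumTo-unfoldˡ (suc n) f = trans (cong (_+ f (suc n)) (sumTo-unfoldˡ n f)) (ℤ.+-assoc (f 0) _ _)

  sumTo-reverse : ∀ n (f : ℕ → ℤ) → sumTo n f ≡ sumTo n (λ i → f (n ∸ suc i))
  sumTo-reverse zero    f = refl
  sumTo-reverse (suc n) f = trans (cong (_+ f n) (sumTo-reverse n f))
    (trans (ℤ.+-comm _ (f n)) (sym (sumTo-unfoldˡ n (λ i → f (n ∸ i)))))

  sumTo-comm : ∀ a b (F : ℕ → ℕ → ℤ) → sumTo a (λ i → sumTo b (F i)) ≡ sumTo b (λ j → sumTo a (λ i → F i j))
  sumTo-comm zero    b F = sym (sumTo-≡0 b (λ _ _ → refl))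
  sumTo-comm (suc a) b F = trans (cong (_+ sumTo b (F a)) (sumTo-comm a b F)) (sym (sumTo-+ b _ _))

  sumTo-split : ∀ m k (f : ℕ → ℤ) → sumTo (m ℕ.+ k) f ≡ sumTo m f + sumTo k (λ i → f (m ℕ.+ i))
  sumTo-split m zero    f = trans (cong (λ x → sumTo x f) (ℕ.+-identityʳ m)) (sym (ℤ.+-identityʳ _))
  sumTo-split m (suc k) f = trans (cong (λ x → sumTo x f) (ℕ.+-suc m k))
    (trans (cong (_+ f (m ℕ.+ k)) (sumTo-split m k f)) (ℤ.+-assoc (sumTo m f) _ _))

  sumTo-triangle : ∀ n (F : ℕ → ℕ → ℤ) →
    sumTo (suc n) (λ i → sumTo (suc i) (F i)) ≡ sumTo (suc n) (λ j → sumTo (suc (n ∸ j)) (λ k → F (j ℕ.+ k) j))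
  sumTo-triangle zero    F = refl
  sumTo-triangle (suc n) F = begin
    sumTo (suc n) (λ i → sumTo (suc i) (F i)) + sumTo (suc (suc n)) (F (suc n))
      ≡⟨ cong (_+ sumTo (suc (suc n)) (F (suc n))) (sumTo-triangle n F) ⟩
    Lower + (sumTo (suc n) (F (suc n)) + F (suc n) (suc n))
      ≡⟨ ℤ.+-assoc Lower (sumTo (suc n) (F (suc n))) (F (suc n) (suc n)) ⟨
    (Lower + sumTo (suc n) (F (suc n))) + F (suc n) (suc n)
      ≡⟨ cong (_+ F (suc n) (suc n)) (trans (sym (sumTo-+ (suc n) _ _)) (sumTo-cong (suc n) extend)) ⟩
    sumTo (suc n) (λ j → sumTo (suc (suc n ∸ j)) (λ k → F (j ℕ.+ k) j)) + F (suc n) (suc n)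
      ≡⟨ cong (λ x → Upper + x) last ⟩
    sumTo (suc n) (λ j → sumTo (suc (suc n ∸ j)) (λ k → F (j ℕ.+ k) j)) + sumTo (suc (n ∸ n)) (λ k → F (suc n ℕ.+ k) (suc n)) ∎
    where
    Lower Upper : ℤ
    Lower = sumTo (suc n) (λ j → sumTo (suc (n ∸ j)) (λ k → F (j ℕ.+ k) j))
    Upper = sumTo (suc n) (λ j → sumTo (suc (suc n ∸ j)) (λ k → F (j ℕ.+ k) j))
    last : F (suc n) (suc n) ≡ sumTo (suc (n ∸ n)) (λ k → F (suc n ℕ.+ k) (suc n))
    last rewrite ℕ.n∸n≡0 n | ℕ.+-identityʳ n = sym (ℤ.+-identityˡ _)
    extend : ∀ j → j < suc n → sumTo (suc (n ∸ j)) (λ k → F (j ℕ.+ k) j) + F (suc n) j ≡ sumTo (suc (suc n ∸ j)) (λ k → F (j ℕ.+ k) j)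
    extend j (s≤s j≤n) rewrite ℕ.+-∸-assoc 1 j≤n =
      cong (λ x → sumTo (suc (n ∸ j)) (λ k → F (j ℕ.+ k) j) + F x j)
        (sym (trans (ℕ.+-suc j (n ∸ j)) (cong suc (ℕ.m+[n∸m]≡n j≤n))))

  sumTo-extend : ∀ m M (f : ℕ → ℤ) → m ≤ M → (∀ i → m ≤ i → i < M → f i ≡ + 0) → sumTo M f ≡ sumTo m f
  sumTo-extend m M f m≤M f≡0 = begin
    sumTo M f                                      ≡⟨ cong (λ k → sumTo k f) (ℕ.m+[n∸m]≡n m≤M) ⟨
    sumTo (m ℕ.+ (M ∸ m)) f                        ≡⟨ sumTo-split m (M ∸ m) f ⟩
    sumTo m f + sumTo (M ∸ m) (λ i → f (m ℕ.+ i))  ≡⟨ cong (λ x → sumTo m f + x) (sumTo-≡0 (M ∸ m) beyond) ⟩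
    sumTo m f + + 0                                ≡⟨ ℤ.+-identityʳ _ ⟩
    sumTo m f                                      ∎
    where
    beyond : ∀ i → i < M ∸ m → f (m ℕ.+ i) ≡ + 0
    beyond i i<M-m = f≡0 (m ℕ.+ i) (ℕ.m≤m+n m i) (≡.subst (m ℕ.+ i <_) (ℕ.m+[n∸m]≡n m≤M) (ℕ.+-monoʳ-< m i<M-m))

  sumTo-parity : ∀ n (f : ℕ → ℤ) → sumTo (n ℕ.+ n) f ≡ sumTo n (λ i → f (2 ℕ.* i)) + sumTo n (λ i → f (2 ℕ.* i ℕ.+ 1))
  sumTo-parity zero    f = refl
  sumTo-parity (suc n) f = begin
    sumTo (suc n ℕ.+ suc n) f                              ≡⟨ cong (λ k → sumTo (suc k) f) (ℕ.+-suc n n) ⟩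
    sumTo (n ℕ.+ n) f + f (n ℕ.+ n) + f (suc (n ℕ.+ n))    ≡⟨ cong (λ x → x + f (n ℕ.+ n) + f (suc (n ℕ.+ n))) (sumTo-parity n f) ⟩
    (E + O) + f (n ℕ.+ n) + f (suc (n ℕ.+ n))
      ≡⟨ cong₂ (λ u v → (E + O) + f u + f v) n+n≡2n (trans (cong suc n+n≡2n) (ℕ.+-comm 1 (2 ℕ.* n))) ⟩
    (E + O) + f (2 ℕ.* n) + f (2 ℕ.* n ℕ.+ 1)              ≡⟨ ℤ.+-assoc (E + O) _ _ ⟩
    (E + O) + (f (2 ℕ.* n) + f (2 ℕ.* n ℕ.+ 1))            ≡⟨ interchange E O _ _ ⟩
    (E + f (2 ℕ.* n)) + (O + f (2 ℕ.* n ℕ.+ 1))            ∎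
    where
    E O : ℤ
    E = sumTo n (λ i → f (2 ℕ.* i))
    O = sumTo n (λ i → f (2 ℕ.* i ℕ.+ 1))
    n+n≡2n : n ℕ.+ n ≡ 2 ℕ.* n
    n+n≡2n = cong (n ℕ.+_) (sym (ℕ.+-identityʳ n))

  sumTo-parity-≥ : ∀ n (f : ℕ → ℤ) → (∀ j → n ≤ j → f j ≡ + 0) →
                   sumTo n f ≡ sumTo n (λ i → f (2 ℕ.* i)) + sumTo n (λ i → f (2 ℕ.* i ℕ.+ 1))
  sumTo-parity-≥ n f f≡0 = trans (sym (sumTo-extend n (n ℕ.+ n) f (ℕ.m≤m+n n n) (λ j n≤j _ → f≡0 j n≤j))) (sumTo-parity n f)

  𝕀 : Bool → ℤ
  𝕀 b = if b then + 1 else + 0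

  δ : ℕ → ℕ → ℤ
  δ k i = 𝕀 (does (i ℕ.≟ k))

  δ-self : ∀ k → δ k k ≡ + 1
  δ-self k = cong 𝕀 (dec-true (k ℕ.≟ k) refl)

  δ-≢ : ∀ {k i} → i ≢ k → δ k i ≡ + 0
  δ-≢ {k} {i} i≢k = cong 𝕀 (dec-false (i ℕ.≟ k) i≢k)

  sumTo-δ-≥ : ∀ N k (h : ℕ → ℤ) → N ≤ k → sumTo N (λ i → δ k i * h i) ≡ + 0
  sumTo-δ-≥ zero    k h _   = refl
  sumTo-δ-≥ (suc N) k h N<k = cong₂ _+_ (sumTo-δ-≥ N k h (ℕ.≤-trans (ℕ.n≤1+n N) N<k))
    (cong (_* h N) (δ-≢ (λ N≡k → ℕ.<-irrefl N≡k N<k)))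

  sumTo-δ : ∀ N k (h : ℕ → ℤ) → k < N → sumTo N (λ i → δ k i * h i) ≡ h k
  sumTo-δ (suc N) k h (s≤s k≤N) with ℕ.m≤n⇒m<n∨m≡n k≤N
  ... | inj₁ k<N  = trans (cong₂ _+_ (sumTo-δ N k h k<N) (cong (_* h N) (δ-≢ (λ N≡k → ℕ.<-irrefl (sym N≡k) k<N))))
                          (ℤ.+-identityʳ (h k))
  ... | inj₂ refl = trans (cong₂ _+_ (sumTo-δ-≥ N N h ℕ.≤-refl) (cong (_* h N) (δ-self N)))
                          (trans (ℤ.+-identityˡ (+ 1 * h N)) (ℤ.*-identityˡ (h N)))

  sumTo-above : ∀ n b (h : ℕ → ℤ) → (∀ a → n ≤ a → h a ≡ + 0) →
                sumTo n (λ a → 𝕀 (does (b ℕ.<? a)) * h a) ≡ sumTo n (λ d → h (suc b ℕ.+ d))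
  sumTo-above n b h h≡0 = begin
    sumTo n g                                              ≡⟨ sumTo-extend n (suc b ℕ.+ n) g (ℕ.m≤n+m n (suc b)) (λ i n≤i _ → g≡0 i n≤i) ⟨
    sumTo (suc b ℕ.+ n) g                                  ≡⟨ sumTo-split (suc b) n g ⟩
    sumTo (suc b) g + sumTo n (λ d → g (suc b ℕ.+ d))      ≡⟨ cong₂ _+_ (sumTo-≡0 (suc b) below) (sumTo-cong n (λ d _ → above d)) ⟩
    + 0 + sumTo n (λ d → h (suc b ℕ.+ d))                  ≡⟨ ℤ.+-identityˡ _ ⟩
    sumTo n (λ d → h (suc b ℕ.+ d))                        ∎
    where
    g : ℕ → ℤ
    g a = 𝕀 (does (b ℕ.<? a)) * h a
    g≡0 : ∀ i → n ≤ i → g i ≡ + 0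
    g≡0 i n≤i = trans (cong (𝕀 (does (b ℕ.<? i)) *_) (h≡0 i n≤i)) (ℤ.*-zeroʳ (𝕀 (does (b ℕ.<? i))))
    below : ∀ i → i < suc b → g i ≡ + 0
    below i (s≤s i≤b) = cong (λ x → 𝕀 x * h i) (dec-false (b ℕ.<? i) (ℕ.≤⇒≯ i≤b))
    above : ∀ d → g (suc b ℕ.+ d) ≡ h (suc b ℕ.+ d)
    above d = trans (cong (λ x → 𝕀 x * h (suc b ℕ.+ d)) (dec-true (b ℕ.<? suc b ℕ.+ d) (s≤s (ℕ.m≤m+n b d)))) (ℤ.*-identityˡ _)

  trichotomy : ∀ a b v → 𝕀 (does (b ℕ.<? a)) * v + δ a b * v + 𝕀 (does (a ℕ.<? b)) * v ≡ v
  trichotomy a b v with ℕ.<-cmp b a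
  ... | tri< b<a b≢a a≮b rewrite dec-true (b ℕ.<? a) b<a | δ-≢ b≢a | dec-false (a ℕ.<? b) a≮b =
    trans (ℤ.+-identityʳ _) (trans (ℤ.+-identityʳ _) (ℤ.*-identityˡ v))
  ... | tri≈ b≮a refl a≮b rewrite dec-false (b ℕ.<? b) b≮a | δ-self b =
    trans (ℤ.+-identityʳ _) (trans (ℤ.+-identityˡ _) (ℤ.*-identityˡ v))
  ... | tri> b≮a b≢a a<b rewrite dec-false (b ℕ.<? a) b≮a | δ-≢ b≢a | dec-true (a ℕ.<? b) a<b =
    trans (ℤ.+-identityˡ _) (ℤ.*-identityˡ v)

  sumTo² : ℕ → (ℕ → ℕ → ℤ) → ℤ
  sumTo² n F = sumTo n (λ x → sumTo n (F x))

  sumTo³ : ℕ → (ℕ → ℕ → ℕ → ℤ) → ℤ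
  sumTo³ n F = sumTo n (λ x → sumTo² n (F x))

  sumTo²-cong : ∀ n {F G : ℕ → ℕ → ℤ} → (∀ x y → x < n → y < n → F x y ≡ G x y) → sumTo² n F ≡ sumTo² n G
  sumTo²-cong n F≡G = sumTo-cong n (λ x x<n → sumTo-cong n (λ y y<n → F≡G x y x<n y<n))

  sumTo³-cong : ∀ n {F G : ℕ → ℕ → ℕ → ℤ} → (∀ x y z → x < n → y < n → z < n → F x y z ≡ G x y z) → sumTo³ n F ≡ sumTo³ n G
  sumTo³-cong n F≡G = sumTo-cong n (λ x x<n → sumTo²-cong n (λ y z y<n z<n → F≡G x y z x<n y<n z<n))

  sumTo²-comm : ∀ n F → sumTo² n F ≡ sumTo² n (λ x y → F y x)
  sumTo²-comm n F = sumTo-comm n n F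

  sumTo³-comm₁₂ : ∀ n F → sumTo³ n F ≡ sumTo³ n (λ x y z → F y x z)
  sumTo³-comm₁₂ n F = sumTo-comm n n (λ x y → sumTo n (F x y))

  sumTo³-comm₂₃ : ∀ n F → sumTo³ n F ≡ sumTo³ n (λ x y z → F x z y)
  sumTo³-comm₂₃ n F = sumTo-cong n (λ x _ → sumTo-comm n n (F x))

  sumTo²-+ : ∀ n F G → sumTo² n (λ x y → F x y + G x y) ≡ sumTo² n F + sumTo² n G
  sumTo²-+ n F G = trans (sumTo-cong n (λ x _ → sumTo-+ n (F x) (G x))) (sumTo-+ n _ _)

  sumTo³-+ : ∀ n F G → sumTo³ n (λ x y z → F x y z + G x y z) ≡ sumTo³ n F + sumTo³ n G
  sumTo³-+ n F G = trans (sumTo-cong n (λ x _ → sumTo²-+ n (F x) (G x))) (sumTo-+ n _ _)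

  sumTo³-neg : ∀ n F → sumTo³ n (λ x y z → - F x y z) ≡ - sumTo³ n F
  sumTo³-neg n F = trans (sumTo-cong n (λ x _ → trans (sumTo-cong n (λ y _ → sumTo-neg n (F x y))) (sumTo-neg n _))) (sumTo-neg n _)

  sumTo²-trichotomy : ∀ n F → sumTo² n F ≡
    sumTo² n (λ a b → 𝕀 (does (b ℕ.<? a)) * F a b) + sumTo n (λ a → F a a) + sumTo² n (λ a b → 𝕀 (does (a ℕ.<? b)) * F a b)
  sumTo²-trichotomy n F = begin
    sumTo² n F                                       ≡⟨ sumTo²-cong n (λ a b _ _ → sym (trichotomy a b (F a b))) ⟩
    sumTo² n (λ a b → (A a b + M a b) + C a b)       ≡⟨ sumTo²-+ n _ C ⟩
    sumTo² n (λ a b → A a b + M a b) + sumTo² n C    ≡⟨ cong (_+ sumTo² n C) (sumTo²-+ n A M) ⟩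
    sumTo² n A + sumTo² n M + sumTo² n C
      ≡⟨ cong (λ x → sumTo² n A + x + sumTo² n C) (sumTo-cong n (λ a a<n → sumTo-δ n a (F a) a<n)) ⟩
    sumTo² n A + sumTo n (λ a → F a a) + sumTo² n C  ∎
    where
    A M C : ℕ → ℕ → ℤ
    A a b = 𝕀 (does (b ℕ.<? a)) * F a b
    M a b = δ a b * F a b
    C a b = 𝕀 (does (a ℕ.<? b)) * F a b

  sumTo³-trichotomy : ∀ n F → sumTo³ n F ≡
    sumTo³ n (λ x a b → 𝕀 (does (b ℕ.<? a)) * F x a b) + sumTo² n (λ x a → F x a a) + sumTo³ n (λ x a b → 𝕀 (does (a ℕ.<? b)) * F x a b)
  sumTo³-trichotomy n F = trans (sumTo-cong n (λ x _ → sumTo²-trichotomy n (F x)))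
    (trans (sumTo-+ n _ _) (cong (_+ sumTo³ n (λ x a b → 𝕀 (does (a ℕ.<? b)) * F x a b)) (sumTo-+ n _ _)))


module PowerSeries where

  open import Data.Integer using (+_; -_; _*_; _+_)
  open import Data.Product using (_,_)
  open import Relation.Binary.Structures using (IsEquivalence)
  open ≡ using (refl; cong; cong₂; sym; trans)
  open ≡.≡-Reasoning
  open IntegerSums

  infix 4 _≈ₛ_
  _≈ₛ_ : Series → Series → Set
  f ≈ₛ g = ∀ n → f n ≡ g n

  infixl 6 _+ₛ_
  infix  8 -ₛ_

  _+ₛ_ : Series → Series → Series
  (f +ₛ g) n = f n + g n

  -ₛ_ : Series → Series
  (-ₛ f) n = - f n

  0ₛ : Series
  0ₛ n = + 0

  ⊛-cong : ∀ {f f′ g g′} → f ≈ₛ f′ → g ≈ₛ g′ → f ⊛ g ≈ₛ f′ ⊛ g′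
  ⊛-cong f≈f′ g≈g′ n = sumTo-cong (suc n) (λ i _ → cong₂ _*_ (f≈f′ i) (g≈g′ (n ∸ i)))

  ⊛-comm : ∀ f g → f ⊛ g ≈ₛ g ⊛ f
  ⊛-comm f g n = trans (sumTo-reverse (suc n) _) (sumTo-cong (suc n) reflect)
    where
    reflect : ∀ i → i < suc n → f (n ∸ i) * g (n ∸ (n ∸ i)) ≡ g i * f (n ∸ i)
    reflect i (s≤s i≤n) = trans (cong (λ x → f (n ∸ i) * g x) (ℕ.m∸[m∸n]≡n i≤n)) (ℤ.*-comm (f (n ∸ i)) (g i))

  ⊛-identityˡ : ∀ f → oneS ⊛ f ≈ₛ f
  ⊛-identityˡ f n = begin
    sumTo (suc n) (λ i → oneS i * f (n ∸ i))          ≡⟨ sumTo-unfoldˡ n _ ⟩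
    + 1 * f n + sumTo n (λ i → + 0 * f (n ∸ suc i))   ≡⟨ cong (λ x → + 1 * f n + x) (sumTo-≡0 n (λ _ _ → refl)) ⟩
    + 1 * f n + + 0                                   ≡⟨ ℤ.+-identityʳ _ ⟩
    + 1 * f n                                         ≡⟨ ℤ.*-identityˡ (f n) ⟩
    f n                                               ∎

  ⊛-distribˡ : ∀ f g h → f ⊛ (g +ₛ h) ≈ₛ (f ⊛ g) +ₛ (f ⊛ h)
  ⊛-distribˡ f g h n = trans (sumTo-cong (suc n) (λ i _ → ℤ.*-distribˡ-+ (f i) _ _)) (sumTo-+ (suc n) _ _)

  ⊛-assoc : ∀ f g h → (f ⊛ g) ⊛ h ≈ₛ f ⊛ (g ⊛ h)
  ⊛-assoc f g h n = begin
    sumTo (suc n) (λ i → sumTo (suc i) (λ j → f j * g (i ∸ j)) * h (n ∸ i))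
      ≡⟨ sumTo-cong (suc n) (λ i _ → sym (sumTo-*ʳ (suc i) (h (n ∸ i)) _)) ⟩
    sumTo (suc n) (λ i → sumTo (suc i) (λ j → f j * g (i ∸ j) * h (n ∸ i)))
      ≡⟨ sumTo-triangle n (λ i j → f j * g (i ∸ j) * h (n ∸ i)) ⟩
    sumTo (suc n) (λ j → sumTo (suc (n ∸ j)) (λ k → f j * g ((j ℕ.+ k) ∸ j) * h (n ∸ (j ℕ.+ k))))
      ≡⟨ sumTo-cong (suc n) (λ j _ → sumTo-cong (suc (n ∸ j)) (λ k _ → reindex j k)) ⟩
    sumTo (suc n) (λ j → sumTo (suc (n ∸ j)) (λ k → f j * (g k * h ((n ∸ j) ∸ k))))
      ≡⟨ sumTo-cong (suc n) (λ j _ → sumTo-*ˡ (suc (n ∸ j)) (f j) _) ⟩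
    sumTo (suc n) (λ j → f j * sumTo (suc (n ∸ j)) (λ k → g k * h ((n ∸ j) ∸ k))) ∎
    where
    reindex : ∀ j k → f j * g ((j ℕ.+ k) ∸ j) * h (n ∸ (j ℕ.+ k)) ≡ f j * (g k * h ((n ∸ j) ∸ k))
    reindex j k = trans (cong₂ (λ a b → f j * g a * h b) (ℕ.m+n∸m≡n j k) (sym (ℕ.∸-+-assoc n j k))) (ℤ.*-assoc (f j) _ _)

  ≈ₛ-isEquivalence : IsEquivalence _≈ₛ_
  ≈ₛ-isEquivalence = record
    { refl  = λ _ → refl
    ; sym   = λ f≈g n → sym (f≈g n)
    ; trans = λ f≈g g≈h n → trans (f≈g n) (g≈h n)
    }

  seriesRing : CommutativeRing _ _
  seriesRing = record
    { Carrier = Series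
    ; _≈_ = _≈ₛ_
    ; _+_ = _+ₛ_
    ; _*_ = _⊛_
    ; -_ = -ₛ_
    ; 0# = 0ₛ
    ; 1# = oneS
    ; isCommutativeRing = record
      { isRing = record
        { +-isAbelianGroup = record
          { isGroup = record
            { isMonoid = record
              { isSemigroup = record
                { isMagma = record
                  { isEquivalence = ≈ₛ-isEquivalence
                  ; ∙-cong = λ p q n → cong₂ _+_ (p n) (q n)
                  }
                ; assoc = λ f g h n → ℤ.+-assoc (f n) (g n) (h n)
                }
              ; identity = (λ f n → ℤ.+-identityˡ (f n)) , (λ f n → ℤ.+-identityʳ (f n))
              }
            ; inverse = (λ f n → ℤ.+-inverseˡ (f n)) , (λ f n → ℤ.+-inverseʳ (f n))
            ; ⁻¹-cong = λ p n → cong -_ (p n)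
            }
          ; comm = λ f g n → ℤ.+-comm (f n) (g n)
          }
        ; *-cong = ⊛-cong
        ; *-assoc = ⊛-assoc
        ; *-identity = ⊛-identityˡ , (λ f n → trans (⊛-comm f oneS n) (⊛-identityˡ f n))
        ; distrib = ⊛-distribˡ , (λ f g h n → trans (⊛-comm (g +ₛ h) f n)
                                   (trans (⊛-distribˡ f g h n) (cong₂ _+_ (⊛-comm f g n) (⊛-comm f h n))))
        }
      ; *-comm = ⊛-comm
      }
    }


module Monomials where

  open import Data.Nat.Divisibility using (_∣_; _∣?_; divides; ∣m+n∣m⇒∣n; ∣-refl; _∣0; ∣⇒≤)
  open import Data.Nat.DivMod using (m*n/n≡m)
  open import Data.Integer using (+_; _+_)
  open import Data.Bool using (true; false; if_then_else_)
  open import Relation.Nullary.Decidable using (dec-true; dec-false; does-⇔)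
  open import Function.Bundles using (mk⇔)
  open ≡ using (refl; cong; cong₂; sym; trans)
  open IntegerSums
  open PowerSeries
  private module S = CommutativeRing seriesRing
  open import Algebra.Properties.Semiring.Exp S.semiring using (_^_)

  monomial : ℕ → Series
  monomial = δ

  monomial-⊛-< : ∀ k f n → n < k → (monomial k ⊛ f) n ≡ + 0
  monomial-⊛-< k f n n<k = sumTo-δ-≥ (suc n) k (λ i → f (n ∸ i)) n<k

  monomial-⊛-+ : ∀ k f m → (monomial k ⊛ f) (k ℕ.+ m) ≡ f m
  monomial-⊛-+ k f m = trans (sumTo-δ (suc (k ℕ.+ m)) k (λ i → f (k ℕ.+ m ∸ i)) (s≤s (ℕ.m≤m+n k m)))
                             (cong f (ℕ.m+n∸m≡n k m))

  private
    by-offset : ∀ {P : ℕ → Set} k → (∀ n → n < k → P n) → (∀ m → P (k ℕ.+ m)) → ∀ n → P n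
    by-offset {P} k below above n with n ℕ.<? k
    ... | yes n<k = below n n<k
    ... | no  n≮k = ≡.subst P (ℕ.m+[n∸m]≡n (ℕ.≮⇒≥ n≮k)) (above (n ∸ k))

  monomial-+ : ∀ a b → monomial a ⊛ monomial b ≈ₛ monomial (a ℕ.+ b)
  monomial-+ a b = by-offset a below above
    where
    below : ∀ n → n < a → (monomial a ⊛ monomial b) n ≡ monomial (a ℕ.+ b) n
    below n n<a = trans (monomial-⊛-< a (monomial b) n n<a)
                        (sym (δ-≢ (λ n≡a+b → ℕ.<-irrefl n≡a+b (ℕ.<-≤-trans n<a (ℕ.m≤m+n a b)))))
    above : ∀ m → (monomial a ⊛ monomial b) (a ℕ.+ m) ≡ monomial (a ℕ.+ b) (a ℕ.+ m)
    above m = trans (monomial-⊛-+ a (monomial b) m)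
                    (cong 𝕀 (does-⇔ (mk⇔ (cong (a ℕ.+_)) (ℕ.+-cancelˡ-≡ a m b)) (m ℕ.≟ b) (a ℕ.+ m ℕ.≟ a ℕ.+ b)))

  monomial-^ : ∀ d k → monomial d ^ k ≈ₛ monomial (k ℕ.* d)
  monomial-^ d zero    zero    = refl
  monomial-^ d zero    (suc n) = refl
  monomial-^ d (suc k)         = S.trans (S.*-congˡ {monomial d} (monomial-^ d k)) (monomial-+ d (k ℕ.* d))

  oneMinus≈1-X^ : ∀ m → oneMinus m ≈ₛ oneS +ₛ -ₛ monomial (suc m)
  oneMinus≈1-X^ m zero    = refl
  oneMinus≈1-X^ m (suc n) with does (suc n ℕ.≟ suc m)
  ... | true  = refl
  ... | false = refl

  private
    sgn-suc+sgn : ∀ q → sgn (suc q) + sgn q ≡ + 0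
    sgn-suc+sgn zero          = refl
    sgn-suc+sgn (suc zero)    = refl
    sgn-suc+sgn (suc (suc q)) = sgn-suc+sgn q

    invOnePlus-∣ : ∀ m {n} → suc m ∣ n → invOnePlus m n ≡ sgn (n / suc m)
    invOnePlus-∣ m {n} k∣n = cong (λ b → if b then sgn (n / suc m) else + 0) (dec-true (suc m ∣? n) k∣n)

    invOnePlus-∤ : ∀ m {n} → ¬ suc m ∣ n → invOnePlus m n ≡ + 0
    invOnePlus-∤ m {n} k∤n = cong (λ b → if b then sgn (n / suc m) else + 0) (dec-false (suc m ∣? n) k∤n)

    invOnePlus-period : ∀ m r → invOnePlus m (suc m ℕ.+ r) + invOnePlus m r ≡ + 0
    invOnePlus-period m r with suc m ∣? r
    ... | yes (divides q refl) = begin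
      invOnePlus m (suc q ℕ.* suc m) + invOnePlus m (q ℕ.* suc m)
        ≡⟨ cong₂ _+_ (invOnePlus-∣ m (divides (suc q) refl)) (invOnePlus-∣ m (divides q refl)) ⟩
      sgn (suc q ℕ.* suc m / suc m) + sgn (q ℕ.* suc m / suc m)
        ≡⟨ cong₂ (λ x y → sgn x + sgn y) (m*n/n≡m (suc q) (suc m)) (m*n/n≡m q (suc m)) ⟩
      sgn (suc q) + sgn q
        ≡⟨ sgn-suc+sgn q ⟩
      + 0 ∎
      where open ≡.≡-Reasoning
    ... | no  k∤r = cong₂ _+_ (invOnePlus-∤ m (λ k∣k+r → k∤r (∣m+n∣m⇒∣n k∣k+r ∣-refl))) (invOnePlus-∤ m k∤r)

    invOnePlus-below : ∀ m n → n < suc m → invOnePlus m n ≡ oneS n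
    invOnePlus-below m zero    _         = invOnePlus-∣ m (suc m ∣0)
    invOnePlus-below m (suc n) (s≤s n<m) = invOnePlus-∤ m (λ k∣n → ℕ.<-irrefl refl (ℕ.≤-trans (∣⇒≤ k∣n) n<m))

  invOnePlus-inverse : ∀ m → (oneS +ₛ monomial (suc m)) ⊛ invOnePlus m ≈ₛ oneS
  invOnePlus-inverse m n = trans (⊛-comm (oneS +ₛ monomial (suc m)) (invOnePlus m) n)
    (trans (⊛-distribˡ (invOnePlus m) oneS (monomial (suc m)) n)
    (trans (cong₂ _+_ (⊛-comm (invOnePlus m) oneS n) (⊛-comm (invOnePlus m) (monomial (suc m)) n))
      (by-offset (suc m) below above n)))
    where
    below : ∀ n → n < suc m → (oneS ⊛ invOnePlus m) n + (monomial (suc m) ⊛ invOnePlus m) n ≡ oneS n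
    below n n<k = trans (cong₂ _+_ (⊛-identityˡ (invOnePlus m) n) (monomial-⊛-< (suc m) (invOnePlus m) n n<k))
                        (trans (ℤ.+-identityʳ _) (invOnePlus-below m n n<k))
    above : ∀ r → (oneS ⊛ invOnePlus m) (suc m ℕ.+ r) + (monomial (suc m) ⊛ invOnePlus m) (suc m ℕ.+ r) ≡ oneS (suc m ℕ.+ r)
    above r = trans (cong₂ _+_ (⊛-identityˡ (invOnePlus m) (suc m ℕ.+ r)) (monomial-⊛-+ (suc m) (invOnePlus m) r))
                    (invOnePlus-period m r)



module ThetaProduct where

  open import Data.Integer using (+_; _-_)
  open ≡ using (refl; cong; trans)
  open PowerSeries
  open Monomials
  private module S = CommutativeRing seriesRing
  open import Algebra.Properties.Semiring.Exp S.semiring using (_^_)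

  module Mod₁ = CongruenceModPower seriesRing (monomial 1)
  module Mod₂ = CongruenceModPower seriesRing (monomial 2)
  module Gauss₁ = GaussIdentity seriesRing (monomial 1)
  module Gauss₂ = GaussIdentity seriesRing (monomial 2)

  q^≈monomial : ∀ k → monomial 1 ^ k ≈ₛ monomial k
  q^≈monomial k = S.trans (monomial-^ 1 k) (S.reflexive (cong monomial (ℕ.*-identityʳ k)))

  q²^≈monomial : ∀ k → monomial 2 ^ suc k ≈ₛ monomial (suc (suc (2 ℕ.* k)))
  q²^≈monomial k = S.trans (monomial-^ 2 (suc k)) (S.reflexive (cong (monomial ∘ suc ∘ suc) (ℕ.*-comm k 2)))

  V₁ : ℕ → Series
  V₁ k = invOnePlus k

  V₁-inverse : ∀ k → (oneS +ₛ monomial 1 ^ suc k) ⊛ V₁ k ≈ₛ oneS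
  V₁-inverse k = S.trans (S.*-congʳ {V₁ k} (S.+-congˡ {oneS} (q^≈monomial (suc k)))) (invOnePlus-inverse k)

  V₂ : ℕ → Series
  V₂ k = invOnePlus (suc (2 ℕ.* k))

  V₂-inverse : ∀ k → (oneS +ₛ monomial 2 ^ suc k) ⊛ V₂ k ≈ₛ oneS
  V₂-inverse k = S.trans (S.*-congʳ {V₂ k} (S.+-congˡ {oneS} (q²^≈monomial k))) (invOnePlus-inverse (suc (2 ℕ.* k)))

  Q₁ Q₂ : ℕ → Series
  Q₁ = Gauss₁.quotientPoch V₁ V₁-inverse
  Q₂ = Gauss₂.quotientPoch V₂ V₂-inverse

  partialProd≈ : ∀ N → partialProd N ≈ₛ Q₁ N ⊛ Q₂ N ⊛ Q₂ N
  partialProd≈ zero    = S.sym (S.trans (S.*-identityʳ (oneS ⊛ oneS)) (S.*-identityʳ oneS))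
  partialProd≈ (suc N) =
    FactorRegrouping.product-step seriesRing (partialProd N) (Q₁ N) (Q₂ N) (oneMinus N) α′ (V₁ N) (oneMinus (suc (2 ℕ.* N))) γ′ (V₂ N)
      (partialProd≈ N) α≈α′ γ≈γ′
    where
    α′ γ′ : Series
    α′ = oneS +ₛ -ₛ monomial 1 ^ suc N
    γ′ = oneS +ₛ -ₛ monomial 2 ^ suc N
    α≈α′ : oneMinus N ≈ₛ α′
    α≈α′ = S.trans (oneMinus≈1-X^ N) (S.+-congˡ {oneS} (S.-‿cong (S.sym (q^≈monomial (suc N)))))
    γ≈γ′ : oneMinus (suc (2 ℕ.* N)) ≈ₛ γ′
    γ≈γ′ = S.trans (oneMinus≈1-X^ (suc (2 ℕ.* N))) (S.+-congˡ {oneS} (S.-‿cong (S.sym (q²^≈monomial N))))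

  mod-q²⇒mod-q : ∀ {x y e} → x Mod₂.≈[X^ e ] y → x Mod₁.≈[X^ e ℕ.* 2 ] y
  mod-q²⇒mod-q {x} {y} {e} (Mod₂.divides z x-y≈) =
    Mod₁.divides z (S.trans {x +ₛ -ₛ y} x-y≈ (S.*-congʳ {z} (S.trans (monomial-^ 2 e) (S.sym (q^≈monomial (e ℕ.* 2))))))

  coefficient-< : ∀ {x y e} → x Mod₁.≈[X^ e ] y → ∀ n → n < e → x n ≡ y n
  coefficient-< {x} {y} {e} (Mod₁.divides z x-y≈) n n<e = ℤ.i-j≡0⇒i≡j (x n) (y n) (begin
    x n - y n                    ≡⟨ x-y≈ n ⟩
    (monomial 1 ^ e ⊛ z) n       ≡⟨ ⊛-cong {monomial 1 ^ e} {monomial e} {z} {z} (q^≈monomial e) (λ _ → refl) n ⟩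
    (monomial e ⊛ z) n           ≡⟨ monomial-⊛-< e z n n<e ⟩
    + 0                          ∎)
    where open ≡.≡-Reasoning

  thetaProduct : ℕ → Series
  thetaProduct N = Gauss₁.theta N ⊛ Gauss₂.theta N ⊛ Gauss₂.theta N

  a≡thetaProduct : ∀ n → a n ≡ thetaProduct n n
  a≡thetaProduct n = trans (partialProd≈ n n) (coefficient-< Q≈θ n ℕ.≤-refl)
    where
    Q₂≈θ₂ : Q₂ n Mod₁.≈[X^ suc n ] Gauss₂.theta n
    Q₂≈θ₂ = Mod₁.≈[X^]-weaken (ℕ.m≤m*n (suc n) 2) (mod-q²⇒mod-q (Gauss₂.gauss V₂ V₂-inverse n))
    Q≈θ : Q₁ n ⊛ Q₂ n ⊛ Q₂ n Mod₁.≈[X^ suc n ] thetaProduct n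
    Q≈θ = Mod₁.≈[X^]-* (Mod₁.≈[X^]-* (Gauss₁.gauss V₁ V₁-inverse n) Q₂≈θ₂) Q₂≈θ₂


module ResiduesMod8 where

  open import Data.Nat.DivMod using (%-distribˡ-+; %-distribˡ-*; m%n<n)
  open import Data.Integer using (+_; -_; _*_; _+_)
  open import Data.Bool as Bool using (Bool; true; false)
  open import Data.Empty using (⊥-elim)
  open import Relation.Nullary.Decidable using (True; toWitness; from-yes; _→-dec_)
  open ≡ using (_≢_; refl; cong; cong₂; sym; trans)
  open IntegerSums
  open PowerSeries
  open Monomials
  open ThetaProduct
  private module S = CommutativeRing seriesRing
  open import Algebra.Properties.Semiring.Exp S.semiring using (_^_)
  open import Algebra.Properties.Ring S.ring using (-1*x≈-x)
  open FiniteSums seriesRing using (∑)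

  Residues : Set
  Residues = ℕ → Bool

  record SupportedOn (A : Residues) (f : Series) : Set where
    constructor supported
    field vanishes : ∀ n → A (n % 8) ≡ false → f n ≡ + 0
  open SupportedOn public

  infix 4 _⊕_⊆_
  _⊕_⊆_ : Residues → Residues → Residues → Set
  A ⊕ B ⊆ C = ∀ a b → A (a % 8) ≡ true → B (b % 8) ≡ true → C ((a ℕ.+ b) % 8) ≡ true

  private
    true≢false : true ≢ false
    true≢false ()

    ResidueCheck : Residues → Residues → Residues → Set
    ResidueCheck A B C = ∀ {x} → x < 8 → ∀ {y} → y < 8 → A x ≡ true → B y ≡ true → C ((x ℕ.+ y) % 8) ≡ true

    residueCheck? : ∀ A B C → Dec (ResidueCheck A B C)
    residueCheck? A B C = ℕ.allUpTo? {P = λ x → ∀ {y} → y < 8 → A x ≡ true → B y ≡ true → C ((x ℕ.+ y) % 8) ≡ true}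
      (λ x → ℕ.allUpTo? {P = λ y → A x ≡ true → B y ≡ true → C ((x ℕ.+ y) % 8) ≡ true}
        (λ y → (A x Bool.≟ true) →-dec (B y Bool.≟ true) →-dec (C ((x ℕ.+ y) % 8) Bool.≟ true)) 8) 8

  ⊕⊆-byResidues : ∀ A B C → True (residueCheck? A B C) → A ⊕ B ⊆ C
  ⊕⊆-byResidues A B C check a b a∈A b∈B =
    ≡.subst (λ r → C r ≡ true) (sym (%-distribˡ-+ a b 8)) (toWitness check (m%n<n a 8) (m%n<n b 8) a∈A b∈B)

  supported-≈ : ∀ {A f g} → f ≈ₛ g → SupportedOn A f → SupportedOn A g
  supported-≈ f≈g f∈A = supported (λ n n∉A → trans (sym (f≈g n)) (vanishes f∈A n n∉A))

  supported-0 : ∀ {A} → SupportedOn A 0ₛ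
  supported-0 = supported (λ _ _ → refl)

  supported-+ : ∀ {A f g} → SupportedOn A f → SupportedOn A g → SupportedOn A (f +ₛ g)
  supported-+ f∈A g∈A = supported (λ n n∉A → cong₂ _+_ (vanishes f∈A n n∉A) (vanishes g∈A n n∉A))

  supported-neg : ∀ {A f} → SupportedOn A f → SupportedOn A (-ₛ f)
  supported-neg f∈A = supported (λ n n∉A → cong -_ (vanishes f∈A n n∉A))

  supported-monomial : ∀ {A} k → A (k % 8) ≡ true → SupportedOn A (monomial k)
  supported-monomial {A} k k∈A = supported vanish
    where
    vanish : ∀ n → A (n % 8) ≡ false → monomial k n ≡ + 0
    vanish n n∉A with n ℕ.≟ k
    ... | yes refl = ⊥-elim (true≢false (trans (sym k∈A) n∉A))
    ... | no  n≢k  = δ-≢ n≢k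

  supported-1 : ∀ {A} → A 0 ≡ true → SupportedOn A oneS
  supported-1 {A} 0∈A = supported vanish
    where
    vanish : ∀ n → A (n % 8) ≡ false → oneS n ≡ + 0
    vanish zero    0∉A = ⊥-elim (true≢false (trans (sym 0∈A) 0∉A))
    vanish (suc n) _   = refl

  supported-⊛ : ∀ {A B C f g} → A ⊕ B ⊆ C → SupportedOn A f → SupportedOn B g → SupportedOn C (f ⊛ g)
  supported-⊛ {A} {B} {C} {f} {g} A⊕B⊆C f∈A g∈B = supported (λ n n∉C → sumTo-≡0 (suc n) (term n n∉C))
    where
    term : ∀ n → C (n % 8) ≡ false → ∀ i → i < suc n → f i * g (n ∸ i) ≡ + 0
    term n n∉C i (s≤s i≤n) with A (i % 8) in i∈?A | B ((n ∸ i) % 8) in n-i∈?B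
    ... | false | _     = cong (_* g (n ∸ i)) (vanishes f∈A i i∈?A)
    ... | true  | false = trans (cong (f i *_) (vanishes g∈B (n ∸ i) n-i∈?B)) (ℤ.*-zeroʳ (f i))
    ... | true  | true  = ⊥-elim (true≢false (trans (sym n∈C) n∉C))
      where
      n∈C : C (n % 8) ≡ true
      n∈C = ≡.subst (λ m → C (m % 8) ≡ true) (ℕ.m+[n∸m]≡n i≤n) (A⊕B⊆C i (n ∸ i) i∈?A n-i∈?B)

  supported-sign : ∀ {A} j f → SupportedOn A f → SupportedOn A ((-ₛ oneS) ^ j ⊛ f)
  supported-sign zero    f f∈A = supported-≈ (λ n → sym (⊛-identityˡ f n)) f∈A
  supported-sign (suc j) f f∈A =
    supported-≈ (S.sym (S.trans (S.*-assoc (-ₛ oneS) ((-ₛ oneS) ^ j) f) (-1*x≈-x ((-ₛ oneS) ^ j ⊛ f))))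
                (supported-neg (supported-sign j f f∈A))

  supported-∑ : ∀ {A} N (f : ℕ → Series) → (∀ i → SupportedOn A (f i)) → SupportedOn A (∑ N f)
  supported-∑ zero    f f∈A = supported-0
  supported-∑ (suc N) f f∈A = supported-+ (supported-∑ N f f∈A) (f∈A N)

  x²-residue : Residues
  x²-residue 0 = true
  x²-residue 1 = true
  x²-residue 4 = true
  x²-residue _ = false

  2x²-residue : Residues
  2x²-residue 0 = true
  2x²-residue 2 = true
  2x²-residue _ = false

  x²+2y²-residue : Residues
  x²+2y²-residue 5 = false
  x²+2y²-residue 7 = false
  x²+2y²-residue _ = true

  x²+2y²+2z²-residue : Residues
  x²+2y²+2z²-residue 7 = false
  x²+2y²+2z²-residue _ = true

  square-residue : ∀ j → x²-residue ((j ℕ.* j) % 8) ≡ true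
  square-residue j = ≡.subst (λ r → x²-residue r ≡ true) (sym (%-distribˡ-* j j 8))
    (from-yes (ℕ.allUpTo? {P = λ r → x²-residue ((r ℕ.* r) % 8) ≡ true} (λ r → x²-residue ((r ℕ.* r) % 8) Bool.≟ true) 8) (m%n<n j 8))

  twice-square-residue : ∀ j → 2x²-residue ((j ℕ.* j ℕ.* 2) % 8) ≡ true
  twice-square-residue j =
    ≡.subst (λ r → 2x²-residue r ≡ true) (sym (trans (%-distribˡ-* (j ℕ.* j) 2 8) (cong (λ r → (r ℕ.* 2) % 8) (%-distribˡ-* j j 8))))
      (from-yes (ℕ.allUpTo? {P = λ r → 2x²-residue (((r ℕ.* r) % 8 ℕ.* 2) % 8) ≡ true}
                            (λ r → 2x²-residue (((r ℕ.* r) % 8 ℕ.* 2) % 8) Bool.≟ true) 8) (m%n<n j 8))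

  x²⊕2x² : x²-residue ⊕ 2x²-residue ⊆ x²+2y²-residue
  x²⊕2x² = ⊕⊆-byResidues x²-residue 2x²-residue x²+2y²-residue _

  x²+2y²⊕2x² : x²+2y²-residue ⊕ 2x²-residue ⊆ x²+2y²+2z²-residue
  x²+2y²⊕2x² = ⊕⊆-byResidues x²+2y²-residue 2x²-residue x²+2y²+2z²-residue _

  theta₁-supported : ∀ N → SupportedOn x²-residue (Gauss₁.theta N)
  theta₁-supported N = supported-+ (supported-1 refl) (supported-+ tail tail)
    where
    tail : SupportedOn x²-residue (Gauss₁.thetaTail N)
    tail = supported-∑ N _ (λ i → supported-sign (suc i) _
             (supported-≈ (S.sym (q^≈monomial (suc i ℕ.* suc i))) (supported-monomial (suc i ℕ.* suc i) (square-residue (suc i)))))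

  theta₂-supported : ∀ N → SupportedOn 2x²-residue (Gauss₂.theta N)
  theta₂-supported N = supported-+ (supported-1 refl) (supported-+ tail tail)
    where
    tail : SupportedOn 2x²-residue (Gauss₂.thetaTail N)
    tail = supported-∑ N _ (λ i → supported-sign (suc i) _
             (supported-≈ (S.sym (monomial-^ 2 (suc i ℕ.* suc i))) (supported-monomial (suc i ℕ.* suc i ℕ.* 2) (twice-square-residue (suc i)))))

  thetaProduct-vanishes : ∀ n → n % 8 ≡ 7 → thetaProduct n n ≡ + 0
  thetaProduct-vanishes n n≡7 =
    vanishes (supported-⊛ {x²+2y²-residue} {2x²-residue} {x²+2y²+2z²-residue} x²+2y²⊕2x²
               (supported-⊛ {x²-residue} {2x²-residue} {x²+2y²-residue} x²⊕2x² (theta₁-supported n) (theta₂-supported n))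
               (theta₂-supported n))
      n (cong x²+2y²+2z²-residue n≡7)

  a≡0 : ∀ n → n % 8 ≡ 7 → a n ≡ + 0
  a≡0 n n≡7 = trans (a≡thetaProduct n) (thetaProduct-vanishes n n≡7)


module SymmetricForm where

  open ≡ using (refl; sym)
  import Data.Nat.Solver as ℕ-Solver
  open ℕ-Solver.+-*-Solver using (solve; _:+_; _:*_; _:=_)

  e₂ : ℕ → ℕ → ℕ → ℕ
  e₂ x y z = x ℕ.* y ℕ.+ y ℕ.* z ℕ.+ z ℕ.* x

  odd : ℕ → ℕ
  odd a = 2 ℕ.* a ℕ.+ 1

  even⁺ : ℕ → ℕ
  even⁺ e = 2 ℕ.* e ℕ.+ 2

  e₂-cong : ∀ {x x′ y y′ z z′} → x ≡ x′ → y ≡ y′ → z ≡ z′ → e₂ x y z ≡ e₂ x′ y′ z′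
  e₂-cong refl refl refl = refl

  e₂-comm₁₂ : ∀ x y z → e₂ x y z ≡ e₂ y x z
  e₂-comm₁₂ = solve 3 (λ x y z → x :* y :+ y :* z :+ z :* x := y :* x :+ x :* z :+ z :* y) refl

  e₂-comm₂₃ : ∀ x y z → e₂ x y z ≡ e₂ x z y
  e₂-comm₂₃ = solve 3 (λ x y z → x :* y :+ y :* z :+ z :* x := x :* z :+ z :* y :+ y :* x) refl

  e₂-rotate : ∀ x y z → e₂ x y z ≡ e₂ y z x
  e₂-rotate = solve 3 (λ x y z → x :* y :+ y :* z :+ z :* x := y :* z :+ z :* x :+ x :* y) refl

  x≤e₂ : ∀ x y z → 1 ≤ y → x ≤ e₂ x y z
  x≤e₂ x y z 1≤y =
    ℕ.≤-trans (ℕ.m≤m*n x y {{ℕ.>-nonZero 1≤y}}) (ℕ.≤-trans (ℕ.m≤m+n (x ℕ.* y) (y ℕ.* z)) (ℕ.m≤m+n _ (z ℕ.* x)))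

  y≤e₂ : ∀ x y z → 1 ≤ z → y ≤ e₂ x y z
  y≤e₂ x y z 1≤z = ≡.subst (y ≤_) (sym (e₂-rotate x y z)) (x≤e₂ y z x 1≤z)

  z≤e₂ : ∀ x y z → 1 ≤ x → z ≤ e₂ x y z
  z≤e₂ x y z 1≤x = ≡.subst (z ≤_) (e₂-rotate z x y) (x≤e₂ z x y 1≤x)

  n<odd : ∀ {n a} → n ≤ a → n < odd a
  n<odd {n} {a} n≤a = ≡.subst (n <_) (ℕ.+-comm 1 (2 ℕ.* a)) (s≤s (ℕ.≤-trans n≤a (ℕ.m≤m+n a (a ℕ.+ 0))))

  1≤odd : ∀ a → 1 ≤ odd a
  1≤odd a = ≡.subst (1 ≤_) (ℕ.+-comm 1 (2 ℕ.* a)) (s≤s z≤n)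

  1≤even⁺ : ∀ e → 1 ≤ even⁺ e
  1≤even⁺ e = ≡.subst (1 ≤_) (ℕ.+-comm 2 (2 ℕ.* e)) (s≤s z≤n)

  shifted-product : ∀ r y z → (y ℕ.+ r) ℕ.* (z ℕ.+ r) ≡ e₂ r y z ℕ.+ r ℕ.* r
  shifted-product = solve 3 (λ r y z → (y :+ r) :* (z :+ r) := (r :* y :+ y :* z :+ z :* r) :+ r :* r) refl


module ResidueArithmetic where

  open import Data.Nat.DivMod using (m≡m%n+[m/n]*n; [m+kn]%n≡m%n; m%n<n)
  open import Data.Integer using (+_; -_; _+_; _-_)
  open import Data.Bool as Bool using (Bool; true; false; _∧_)
  open import Relation.Nullary.Decidable using (from-yes; _→-dec_; dec-true; does-⇔)
  open import Function.Bundles using (mk⇔)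
  open ≡ using (refl; cong; cong₂; sym; trans)
  import Data.Nat.Solver as ℕ-Solver
  open ℕ-Solver.+-*-Solver using (solve; _:+_; _:*_; _:=_; con)
  open SymmetricForm
  open IntegerSums using (𝕀)

  sameParity : ℕ → ℕ → Bool
  sameParity u v = does (u % 2 ℕ.≟ v % 2)

  sameParity-refl : ∀ u → sameParity u u ≡ true
  sameParity-refl u = dec-true (u % 2 ℕ.≟ u % 2) refl

  sameParity-sym : ∀ u v → sameParity u v ≡ sameParity v u
  sameParity-sym u v = does-⇔ (mk⇔ sym sym) (u % 2 ℕ.≟ v % 2) (v % 2 ℕ.≟ u % 2)

  sameParity-suc : ∀ u → sameParity (suc u) u ≡ false
  sameParity-suc zero          = refl
  sameParity-suc (suc zero)    = refl
  sameParity-suc (suc (suc u)) = sameParity-suc u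

  sameParity-+-*2 : ∀ u k v → sameParity (u ℕ.+ k ℕ.* 2) v ≡ sameParity u v
  sameParity-+-*2 u k v = cong (λ r → does (r ℕ.≟ v % 2)) ([m+kn]%n≡m%n u k 2)

  all³? : ∀ {P : ℕ → ℕ → ℕ → Set} → (∀ x y z → Dec (P x y z)) → ∀ v →
          Dec (∀ {x} → x < v → ∀ {y} → y < v → ∀ {z} → z < v → P x y z)
  all³? {P} P? v =
    ℕ.allUpTo? {P = λ x → ∀ {y} → y < v → ∀ {z} → z < v → P x y z}
      (λ x → ℕ.allUpTo? {P = λ y → ∀ {z} → z < v → P x y z} (λ y → ℕ.allUpTo? (P? x y) v) v) v

  private
    e₂-mod8 : ∀ x y z X Y Z → e₂ (x ℕ.+ X ℕ.* 8) (y ℕ.+ Y ℕ.* 8) (z ℕ.+ Z ℕ.* 8) % 8 ≡ e₂ x y z % 8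
    e₂-mod8 x y z X Y Z = trans (cong (_% 8) expand) ([m+kn]%n≡m%n (e₂ x y z) K 8)
      where
      K : ℕ
      K = X ℕ.* y ℕ.+ x ℕ.* Y ℕ.+ X ℕ.* Y ℕ.* 8 ℕ.+ Y ℕ.* z ℕ.+ y ℕ.* Z ℕ.+ Y ℕ.* Z ℕ.* 8 ℕ.+ Z ℕ.* x ℕ.+ z ℕ.* X ℕ.+ Z ℕ.* X ℕ.* 8
      expand : e₂ (x ℕ.+ X ℕ.* 8) (y ℕ.+ Y ℕ.* 8) (z ℕ.+ Z ℕ.* 8) ≡ e₂ x y z ℕ.+ K ℕ.* 8
      expand = solve 6 (λ x y z X Y Z →
        (x :+ X :* con 8) :* (y :+ Y :* con 8) :+ (y :+ Y :* con 8) :* (z :+ Z :* con 8) :+ (z :+ Z :* con 8) :* (x :+ X :* con 8)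
          := (x :* y :+ y :* z :+ z :* x)
             :+ (X :* y :+ x :* Y :+ X :* Y :* con 8 :+ Y :* z :+ y :* Z :+ Y :* Z :* con 8 :+ Z :* x :+ z :* X :+ Z :* X :* con 8) :* con 8)
        refl x y z X Y Z

    odd-mod8 : ∀ a → odd a ≡ odd (a % 4) ℕ.+ (a / 4) ℕ.* 8
    odd-mod8 a = trans (cong odd (m≡m%n+[m/n]*n a 4))
      (solve 2 (λ r q → con 2 :* (r :+ q :* con 4) :+ con 1 := (con 2 :* r :+ con 1) :+ q :* con 8) refl (a % 4) (a / 4))

    even⁺-mod8 : ∀ e → even⁺ e ≡ even⁺ (e % 4) ℕ.+ (e / 4) ℕ.* 8
    even⁺-mod8 e = trans (cong even⁺ (m≡m%n+[m/n]*n e 4))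
      (solve 2 (λ r q → con 2 :* (r :+ q :* con 4) :+ con 2 := (con 2 :* r :+ con 2) :+ q :* con 8) refl (e % 4) (e / 4))

    parity-mod4 : ∀ u → u % 2 ≡ (u % 4) % 2
    parity-mod4 u = trans (cong (_% 2) (m≡m%n+[m/n]*n u 4))
      (trans (cong (λ v → (u % 4 ℕ.+ v) % 2) (sym (ℕ.*-assoc (u / 4) 2 2))) ([m+kn]%n≡m%n (u % 4) ((u / 4) ℕ.* 2) 2))

    sameParity-mod4 : ∀ u v → sameParity u v ≡ sameParity (u % 4) (v % 4)
    sameParity-mod4 u v = cong₂ ℕ._≡ᵇ_ (parity-mod4 u) (parity-mod4 v)

  odd-e₂≡7 : ∀ ρ a b → e₂ (odd ρ) (odd a) (odd b) % 8 ≡ 7 → sameParity ρ a ∧ sameParity a b ≡ false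
  odd-e₂≡7 ρ a b e₂≡7 =
    trans (cong₂ _∧_ (sameParity-mod4 ρ a) (sameParity-mod4 a b))
      (from-yes (all³? (λ r a b → (e₂ (odd r) (odd a) (odd b) % 8 ℕ.≟ 7) →-dec (sameParity r a ∧ sameParity a b Bool.≟ false)) 4)
        (m%n<n ρ 4) (m%n<n a 4) (m%n<n b 4) (trans reduce e₂≡7))
    where
    reduce : e₂ (odd (ρ % 4)) (odd (a % 4)) (odd (b % 4)) % 8 ≡ e₂ (odd ρ) (odd a) (odd b) % 8
    reduce = trans (sym (e₂-mod8 (odd (ρ % 4)) (odd (a % 4)) (odd (b % 4)) (ρ / 4) (a / 4) (b / 4)))
                   (cong (_% 8) (e₂-cong (sym (odd-mod8 ρ)) (sym (odd-mod8 a)) (sym (odd-mod8 b))))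

  even-e₂≡7 : ∀ e a b → e₂ (even⁺ e) (odd a) (odd b) % 8 ≡ 7 → sameParity a b ≡ false
  even-e₂≡7 e a b e₂≡7 =
    trans (sameParity-mod4 a b)
      (from-yes (all³? (λ r a b → (e₂ (even⁺ r) (odd a) (odd b) % 8 ℕ.≟ 7) →-dec (sameParity a b Bool.≟ false)) 4)
        (m%n<n e 4) (m%n<n a 4) (m%n<n b 4) (trans reduce e₂≡7))
    where
    reduce : e₂ (even⁺ (e % 4)) (odd (a % 4)) (odd (b % 4)) % 8 ≡ e₂ (even⁺ e) (odd a) (odd b) % 8
    reduce = trans (sym (e₂-mod8 (even⁺ (e % 4)) (odd (a % 4)) (odd (b % 4)) (e / 4) (a / 4) (b / 4)))
                   (cong (_% 8) (e₂-cong (sym (even⁺-mod8 e)) (sym (odd-mod8 a)) (sym (odd-mod8 b))))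

  sgn-periodic : ∀ m j → sgn (m ℕ.+ j ℕ.* 2) ≡ sgn m
  sgn-periodic m zero    = cong sgn (ℕ.+-identityʳ m)
  sgn-periodic m (suc j) = trans (cong sgn (solve 2 (λ m j → m :+ (con 1 :+ j) :* con 2 := con 2 :+ (m :+ j :* con 2)) refl m j))
                                 (sgn-periodic m j)

  private
    halves : ∀ u → u ≡ u % 2 ℕ.+ (u / 2) ℕ.* 2
    halves u = m≡m%n+[m/n]*n u 2

  sgn-odd-triple : ∀ ρ a b → sameParity ρ a ∧ sameParity a b ≡ false →
    sgn (odd ρ ℕ.+ suc a ℕ.+ suc b) ≡ 𝕀 (sameParity ρ a) + 𝕀 (sameParity ρ b) - 𝕀 (sameParity a b)
  sgn-odd-triple ρ a b not-all-equal = begin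
    sgn (odd ρ ℕ.+ suc a ℕ.+ suc b)                             ≡⟨ cong sgn regroup ⟩
    sgn ((1 ℕ.+ a % 2 ℕ.+ b % 2) ℕ.+ (ρ ℕ.+ 1 ℕ.+ a / 2 ℕ.+ b / 2) ℕ.* 2)
                                                                ≡⟨ sgn-periodic (1 ℕ.+ a % 2 ℕ.+ b % 2) (ρ ℕ.+ 1 ℕ.+ a / 2 ℕ.+ b / 2) ⟩
    sgn (1 ℕ.+ a % 2 ℕ.+ b % 2)                                 ≡⟨ table (m%n<n ρ 2) (m%n<n a 2) (m%n<n b 2) not-all-equal ⟩
    𝕀 (sameParity ρ a) + 𝕀 (sameParity ρ b) - 𝕀 (sameParity a b) ∎
    where
    open ≡.≡-Reasoning
    regroup : odd ρ ℕ.+ suc a ℕ.+ suc b ≡ (1 ℕ.+ a % 2 ℕ.+ b % 2) ℕ.+ (ρ ℕ.+ 1 ℕ.+ a / 2 ℕ.+ b / 2) ℕ.* 2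
    regroup = trans (cong₂ (λ u v → odd ρ ℕ.+ suc u ℕ.+ suc v) (halves a) (halves b))
      (solve 5 (λ ρ a′ a₂ b′ b₂ → (con 2 :* ρ :+ con 1) :+ (con 1 :+ (a′ :+ a₂ :* con 2)) :+ (con 1 :+ (b′ :+ b₂ :* con 2))
                                  := (con 1 :+ a′ :+ b′) :+ (ρ :+ con 1 :+ a₂ :+ b₂) :* con 2) refl ρ (a % 2) (a / 2) (b % 2) (b / 2))
    table : ∀ {u} → u < 2 → ∀ {v} → v < 2 → ∀ {w} → w < 2 → (u ℕ.≡ᵇ v) ∧ (v ℕ.≡ᵇ w) ≡ false →
            sgn (1 ℕ.+ v ℕ.+ w) ≡ 𝕀 (u ℕ.≡ᵇ v) + 𝕀 (u ℕ.≡ᵇ w) - 𝕀 (v ℕ.≡ᵇ w)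
    table = from-yes (all³? (λ u v w → ((u ℕ.≡ᵇ v) ∧ (v ℕ.≡ᵇ w) Bool.≟ false) →-dec
                                        (sgn (1 ℕ.+ v ℕ.+ w) ℤ.≟ 𝕀 (u ℕ.≡ᵇ v) + 𝕀 (u ℕ.≡ᵇ w) - 𝕀 (v ℕ.≡ᵇ w))) 2)

  sgn-even-triple : ∀ e a b → sameParity a b ≡ false → sgn (even⁺ e ℕ.+ suc a ℕ.+ suc b) ≡ - (+ 1)
  sgn-even-triple e a b different = begin
    sgn (even⁺ e ℕ.+ suc a ℕ.+ suc b)                           ≡⟨ cong sgn regroup ⟩
    sgn ((a % 2 ℕ.+ b % 2) ℕ.+ (e ℕ.+ 2 ℕ.+ a / 2 ℕ.+ b / 2) ℕ.* 2) ≡⟨ sgn-periodic (a % 2 ℕ.+ b % 2) (e ℕ.+ 2 ℕ.+ a / 2 ℕ.+ b / 2) ⟩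
    sgn (a % 2 ℕ.+ b % 2)                                       ≡⟨ table (m%n<n e 2) (m%n<n a 2) (m%n<n b 2) different ⟩
    - (+ 1)                                                     ∎
    where
    open ≡.≡-Reasoning
    regroup : even⁺ e ℕ.+ suc a ℕ.+ suc b ≡ (a % 2 ℕ.+ b % 2) ℕ.+ (e ℕ.+ 2 ℕ.+ a / 2 ℕ.+ b / 2) ℕ.* 2
    regroup = trans (cong₂ (λ u v → even⁺ e ℕ.+ suc u ℕ.+ suc v) (halves a) (halves b))
      (solve 5 (λ e a′ a₂ b′ b₂ → (con 2 :* e :+ con 2) :+ (con 1 :+ (a′ :+ a₂ :* con 2)) :+ (con 1 :+ (b′ :+ b₂ :* con 2))
                                  := (a′ :+ b′) :+ (e :+ con 2 :+ a₂ :+ b₂) :* con 2) refl e (a % 2) (a / 2) (b % 2) (b / 2))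
    table : ∀ {u} → u < 2 → ∀ {v} → v < 2 → ∀ {w} → w < 2 → (v ℕ.≡ᵇ w) ≡ false → sgn (v ℕ.+ w) ≡ - (+ 1)
    table = from-yes (all³? (λ _ v w → ((v ℕ.≡ᵇ w) Bool.≟ false) →-dec (sgn (v ℕ.+ w) ℤ.≟ - (+ 1))) 2)


module SolutionCounts (n : ℕ) (n≡7 : n % 8 ≡ 7) where

  open import Data.Nat.Divisibility using (_∣_; _∣?_; divides)
  open import Data.Nat.DivMod using (m≡m%n+[m/n]*n; [m+kn]%n≡m%n; m*n%n≡0)
  open import Data.Integer using (ℤ; +_; -_; _*_; _+_; _-_)
  open import Data.Bool using (true; false; if_then_else_)
  open import Data.List using (length; filter; map; applyUpTo)
  open import Data.Empty using (⊥-elim)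
  open import Relation.Nullary.Decidable using (dec-true; dec-false; does-⇔)
  open import Function.Bundles using (mk⇔)
  open ≡ using (_≢_; refl; cong; cong₂; sym; trans)
  open ≡.≡-Reasoning
  open IntegerSums
  open SymmetricForm
  open ResidueArithmetic

  hits : ℕ → ℤ
  hits m = 𝕀 (does (m ℕ.≟ n))

  hits->n : ∀ {m} → n < m → hits m ≡ + 0
  hits->n {m} n<m = cong 𝕀 (dec-false (m ℕ.≟ n) (λ m≡n → ℕ.<-irrefl (sym m≡n) n<m))

  hits≡0 : ∀ m → m ≢ n → hits m ≡ + 0
  hits≡0 m m≢n = cong 𝕀 (dec-false (m ℕ.≟ n) m≢n)

  hits-* : ∀ m {v w} → (m ≡ n → v ≡ w) → hits m * v ≡ hits m * w
  hits-* m {v} {w} v≡w with m ℕ.≟ n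
  ... | yes m≡n = cong (hits m *_) (v≡w m≡n)
  ... | no  m≢n = trans (cong (_* v) (hits≡0 m m≢n)) (sym (cong (_* w) (hits≡0 m m≢n)))

  -- Every solution of e₂ = n or (d + 1)(w + 1) = n is indexed by numbers below n, so all counts range over [0, n).
  signedCount : ℕ → ℤ
  signedCount r = sumTo² n (λ a b → hits (e₂ r (odd a) (odd b)) * sgn (r ℕ.+ suc a ℕ.+ suc b))

  private
    if≡𝕀* : ∀ c v → (if c then v else + 0) ≡ 𝕀 c * v
    if≡𝕀* true  v = sym (ℤ.*-identityˡ v)
    if≡𝕀* false v = refl

    2[1+a]∸1≡odd : ∀ a → 2 ℕ.* suc a ∸ 1 ≡ odd a
    2[1+a]∸1≡odd a = cong (_∸ 1) (double-suc a)
      where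
      double-suc : ∀ a → 2 ℕ.* suc a ≡ 1 ℕ.+ (2 ℕ.* a ℕ.+ 1)
      double-suc = ℕ-Ring.solve-∀

  private
    tripleSum-summand : ∀ r a b →
      (if does ((2 ℕ.* suc a ∸ 1 ℕ.+ r) ℕ.* (2 ℕ.* suc b ∸ 1 ℕ.+ r) ℕ.≟ n ℕ.+ r ℕ.* r) then sgn (r ℕ.+ suc a ℕ.+ suc b) else + 0)
        ≡ hits (e₂ r (odd a) (odd b)) * sgn (r ℕ.+ suc a ℕ.+ suc b)
    tripleSum-summand r a b = trans (if≡𝕀* (does (lhs ℕ.≟ n ℕ.+ r ℕ.* r)) (sgn (r ℕ.+ suc a ℕ.+ suc b)))
      (cong (λ c → 𝕀 c * sgn (r ℕ.+ suc a ℕ.+ suc b))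
        (does-⇔ (mk⇔ (λ p → ℕ.+-cancelʳ-≡ (r ℕ.* r) _ _ (trans (sym product) p)) (λ p → trans product (cong (ℕ._+ r ℕ.* r) p)))
                (lhs ℕ.≟ n ℕ.+ r ℕ.* r) (e₂ r (odd a) (odd b) ℕ.≟ n)))
      where
      lhs : ℕ
      lhs = (2 ℕ.* suc a ∸ 1 ℕ.+ r) ℕ.* (2 ℕ.* suc b ∸ 1 ℕ.+ r)
      product : lhs ≡ e₂ r (odd a) (odd b) ℕ.+ r ℕ.* r
      product = trans (cong₂ (λ u v → (u ℕ.+ r) ℕ.* (v ℕ.+ r)) (2[1+a]∸1≡odd a) (2[1+a]∸1≡odd b)) (shifted-product r (odd a) (odd b))

  tripleSum≡signedCounts : tripleSum n ≡ sumTo n (λ r → signedCount (suc r))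
  tripleSum≡signedCounts = sumTo-cong n (λ r _ → restrict (suc r) (s≤s z≤n))
    where
    W : ℕ → ℕ → ℕ → ℤ
    W r a b = hits (e₂ r (odd a) (odd b)) * sgn (r ℕ.+ suc a ℕ.+ suc b)
    W≡0 : ∀ r a b → n < e₂ r (odd a) (odd b) → W r a b ≡ + 0
    W≡0 r a b n<e₂ = cong (_* sgn (r ℕ.+ suc a ℕ.+ suc b)) (hits->n n<e₂)
    restrict : ∀ r → 1 ≤ r →
      sumTo (n ℕ.+ r ℕ.* r) (λ a → sumTo (n ℕ.+ r ℕ.* r) (λ b →
        if does ((2 ℕ.* suc a ∸ 1 ℕ.+ r) ℕ.* (2 ℕ.* suc b ∸ 1 ℕ.+ r) ℕ.≟ n ℕ.+ r ℕ.* r) then sgn (r ℕ.+ suc a ℕ.+ suc b) else + 0))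
        ≡ signedCount r
    restrict r 1≤r = begin
      _                                 ≡⟨ sumTo-cong B (λ a _ → sumTo-cong B (λ b _ → tripleSum-summand r a b)) ⟩
      sumTo B (λ a → sumTo B (W r a))   ≡⟨ sumTo-cong B (λ a _ → sumTo-extend n B (W r a) (ℕ.m≤m+n n _) (λ b n≤b _ →
                                             W≡0 r a b (ℕ.<-≤-trans (n<odd n≤b) (z≤e₂ r (odd a) (odd b) 1≤r)))) ⟩
      sumTo B (λ a → sumTo n (W r a))   ≡⟨ sumTo-extend n B _ (ℕ.m≤m+n n _) (λ a n≤a _ → sumTo-≡0 n (λ b _ →
                                             W≡0 r a b (ℕ.<-≤-trans (n<odd n≤a) (y≤e₂ r (odd a) (odd b) (1≤odd b))))) ⟩
      signedCount r                     ∎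
      where
      B : ℕ
      B = n ℕ.+ r ℕ.* r

  oddSol evenSol : ℕ → ℕ → ℕ → ℤ
  oddSol  ρ a b = hits (e₂ (odd ρ) (odd a) (odd b))
  evenSol e a b = hits (e₂ (even⁺ e) (odd a) (odd b))

  private
    ≡n⇒%8≡7 : ∀ {m} → m ≡ n → m % 8 ≡ 7
    ≡n⇒%8≡7 m≡n = trans (cong (_% 8) m≡n) n≡7

  signedCounts-by-parity :
    sumTo n (λ r → signedCount (suc r)) ≡ sumTo n (λ ρ → signedCount (odd ρ)) + sumTo n (λ e → signedCount (even⁺ e))
  signedCounts-by-parity = trans (sumTo-parity-≥ n (λ r → signedCount (suc r)) vanish)
    (cong₂ _+_ (sumTo-cong n (λ i _ → cong signedCount (ℕ.+-comm 1 (2 ℕ.* i))))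
               (sumTo-cong n (λ i _ → cong signedCount (trans (ℕ.+-comm 1 (2 ℕ.* i ℕ.+ 1)) (ℕ.+-assoc (2 ℕ.* i) 1 1)))))
    where
    vanish : ∀ r → n ≤ r → signedCount (suc r) ≡ + 0
    vanish r n≤r = sumTo-≡0 n (λ a _ → sumTo-≡0 n (λ b _ →
      cong (_* sgn (suc r ℕ.+ suc a ℕ.+ suc b)) (hits->n (ℕ.<-≤-trans (s≤s n≤r) (x≤e₂ (suc r) (odd a) (odd b) (1≤odd a))))))

  evenCount : ℤ
  evenCount = sumTo³ n evenSol

  evenSignedCount : sumTo n (λ e → signedCount (even⁺ e)) ≡ - evenCount
  evenSignedCount = trans (sumTo³-cong n (λ e a b _ _ _ → sign e a b)) (sumTo³-neg n evenSol)
    where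
    sign : ∀ e a b → evenSol e a b * sgn (even⁺ e ℕ.+ suc a ℕ.+ suc b) ≡ - evenSol e a b
    sign e a b = trans (hits-* (e₂ (even⁺ e) (odd a) (odd b)) (λ e₂≡n → sgn-even-triple e a b (even-e₂≡7 e a b (≡n⇒%8≡7 e₂≡n))))
                       (trans (ℤ.*-comm (evenSol e a b) (- + 1)) (ℤ.-1*i≡-i (evenSol e a b)))

  sameParityCount : ℤ
  sameParityCount = sumTo³ n (λ ρ a b → oddSol ρ a b * 𝕀 (sameParity a b))

  oddSignedCount : sumTo n (λ ρ → signedCount (odd ρ)) ≡ sameParityCount
  oddSignedCount = begin
    sumTo³ n (λ ρ a b → oddSol ρ a b * sgn (odd ρ ℕ.+ suc a ℕ.+ suc b))
      ≡⟨ sumTo³-cong n (λ ρ a b _ _ _ → sign ρ a b) ⟩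
    sumTo³ n (λ ρ a b → (q ρ a b * 𝕀 (sameParity ρ a) + q ρ a b * 𝕀 (sameParity ρ b)) + - (q ρ a b * 𝕀 (sameParity a b)))
      ≡⟨ trans (sumTo³-+ n _ _) (cong₂ _+_ (sumTo³-+ n _ _) (sumTo³-neg n _)) ⟩
    (sumTo³ n (λ ρ a b → q ρ a b * 𝕀 (sameParity ρ a)) + sumTo³ n (λ ρ a b → q ρ a b * 𝕀 (sameParity ρ b))) - sameParityCount
      ≡⟨ cong₂ (λ u v → (u + v) - sameParityCount) relabel₁ relabel₂ ⟩
    (sameParityCount + sameParityCount) - sameParityCount
      ≡⟨ x+x-x≡x sameParityCount ⟩
    sameParityCount ∎
    where
    q G : ℕ → ℕ → ℕ → ℤ
    q = oddSol
    G ρ a b = oddSol ρ a b * 𝕀 (sameParity a b)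
    x+x-x≡x : ∀ x → (x + x) - x ≡ x
    x+x-x≡x = ℤ-Ring.solve-∀
    distrib : ∀ q x y z → q * (x + y - z) ≡ (q * x + q * y) + - (q * z)
    distrib = ℤ-Ring.solve-∀
    sign : ∀ ρ a b → q ρ a b * sgn (odd ρ ℕ.+ suc a ℕ.+ suc b) ≡
                     (q ρ a b * 𝕀 (sameParity ρ a) + q ρ a b * 𝕀 (sameParity ρ b)) + - (q ρ a b * 𝕀 (sameParity a b))
    sign ρ a b = trans (hits-* (e₂ (odd ρ) (odd a) (odd b)) (λ e₂≡n → sgn-odd-triple ρ a b (odd-e₂≡7 ρ a b (≡n⇒%8≡7 e₂≡n))))
                       (distrib (q ρ a b) (𝕀 (sameParity ρ a)) (𝕀 (sameParity ρ b)) (𝕀 (sameParity a b)))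
    q-rotate : ∀ ρ a b → q ρ a b ≡ q b ρ a
    q-rotate ρ a b = cong hits (trans (e₂-comm₂₃ (odd ρ) (odd a) (odd b)) (e₂-comm₁₂ (odd ρ) (odd b) (odd a)))
    q-swap : ∀ ρ a b → q ρ a b ≡ q a ρ b
    q-swap ρ a b = cong hits (e₂-comm₁₂ (odd ρ) (odd a) (odd b))
    relabel₁ : sumTo³ n (λ ρ a b → q ρ a b * 𝕀 (sameParity ρ a)) ≡ sameParityCount
    relabel₁ = trans (sumTo³-cong n (λ ρ a b _ _ _ → cong (_* 𝕀 (sameParity ρ a)) (q-rotate ρ a b)))
                     (trans (sumTo³-comm₂₃ n (λ x y z → G z x y)) (sumTo³-comm₁₂ n (λ x y z → G y x z)))
    relabel₂ : sumTo³ n (λ ρ a b → q ρ a b * 𝕀 (sameParity ρ b)) ≡ sameParityCount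
    relabel₂ = trans (sumTo³-cong n (λ ρ a b _ _ _ → cong (_* 𝕀 (sameParity ρ b)) (q-swap ρ a b))) (sym (sumTo³-comm₁₂ n G))

  diagonalCount : ℤ
  diagonalCount = sumTo² n (λ ρ a → oddSol ρ a a)

  private
    true≢false : true ≢ false
    true≢false ()

    evenSol-diagonal : ∀ e a → evenSol e a a ≡ + 0
    evenSol-diagonal e a = hits≡0 (e₂ (even⁺ e) (odd a) (odd a)) (λ e₂≡n →
      true≢false (trans (sym (sameParity-refl a)) (even-e₂≡7 e a a (≡n⇒%8≡7 e₂≡n))))

    evenSol-swap : ∀ e a b → evenSol e a b ≡ evenSol e b a
    evenSol-swap e a b = cong hits (e₂-comm₂₃ (even⁺ e) (odd a) (odd b))

    oddSol-swap : ∀ ρ a b → oddSol ρ a b ≡ oddSol ρ b a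
    oddSol-swap ρ a b = cong hits (e₂-comm₂₃ (odd ρ) (odd a) (odd b))

  sameParityAbove : ℤ
  sameParityAbove = sumTo³ n (λ ρ a b → 𝕀 (does (b ℕ.<? a)) * (oddSol ρ a b * 𝕀 (sameParity a b)))

  sameParityCount-split : sameParityCount ≡ diagonalCount + (sameParityAbove + sameParityAbove)
  sameParityCount-split = begin
    sameParityCount                                                       ≡⟨ sumTo³-trichotomy n G ⟩
    sameParityAbove + sumTo² n (λ ρ a → G ρ a a) + sumTo³ n (λ ρ a b → 𝕀 (does (a ℕ.<? b)) * G ρ a b)
                                                                          ≡⟨ cong₂ (λ u v → sameParityAbove + u + v) diagonal below ⟩
    sameParityAbove + diagonalCount + sameParityAbove                     ≡⟨ rearrange sameParityAbove diagonalCount ⟩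
    diagonalCount + (sameParityAbove + sameParityAbove)                   ∎
    where
    G : ℕ → ℕ → ℕ → ℤ
    G ρ a b = oddSol ρ a b * 𝕀 (sameParity a b)
    rearrange : ∀ x d → x + d + x ≡ d + (x + x)
    rearrange = ℤ-Ring.solve-∀
    diagonal : sumTo² n (λ ρ a → G ρ a a) ≡ diagonalCount
    diagonal = sumTo²-cong n (λ ρ a _ _ → trans (cong (λ c → oddSol ρ a a * 𝕀 c) (sameParity-refl a)) (ℤ.*-identityʳ _))
    below : sumTo³ n (λ ρ a b → 𝕀 (does (a ℕ.<? b)) * G ρ a b) ≡ sameParityAbove
    below = trans (sumTo³-comm₂₃ n _) (sumTo³-cong n (λ ρ a b _ _ _ →
      cong (𝕀 (does (b ℕ.<? a)) *_) (cong₂ _*_ (oddSol-swap ρ b a) (cong 𝕀 (sameParity-sym b a)))))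

  evenBelow : ℤ
  evenBelow = sumTo³ n (λ e a b → 𝕀 (does (a ℕ.<? b)) * evenSol e a b)

  evenCount-split : evenCount ≡ evenBelow + evenBelow
  evenCount-split = begin
    evenCount                                                              ≡⟨ sumTo³-trichotomy n evenSol ⟩
    sumTo³ n (λ e a b → 𝕀 (does (b ℕ.<? a)) * evenSol e a b) + sumTo² n (λ e a → evenSol e a a) + evenBelow
                                                                           ≡⟨ cong₂ (λ u v → u + v + evenBelow) above diagonal ⟩
    evenBelow + + 0 + evenBelow                                            ≡⟨ cong (_+ evenBelow) (ℤ.+-identityʳ evenBelow) ⟩
    evenBelow + evenBelow                                                  ∎
    where
    above : sumTo³ n (λ e a b → 𝕀 (does (b ℕ.<? a)) * evenSol e a b) ≡ evenBelow
    above = trans (sumTo³-comm₂₃ n _) (sumTo³-cong n (λ e a b _ _ _ → cong (𝕀 (does (a ℕ.<? b)) *_) (evenSol-swap e b a)))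
    diagonal : sumTo² n (λ e a → evenSol e a a) ≡ + 0
    diagonal = sumTo-≡0 n (λ e _ → sumTo-≡0 n (λ a _ → evenSol-diagonal e a))

  private
    oddSol-above : ∀ ρ a b → n ≤ a → oddSol ρ a b ≡ + 0
    oddSol-above ρ a b n≤a = hits->n (ℕ.<-≤-trans (n<odd n≤a) (y≤e₂ (odd ρ) (odd a) (odd b) (1≤odd b)))

    evenSol-above : ∀ e a b → n ≤ b → evenSol e a b ≡ + 0
    evenSol-above e a b n≤b = hits->n (ℕ.<-≤-trans (n<odd n≤b) (z≤e₂ (even⁺ e) (odd a) (odd b) (1≤even⁺ e)))

    even-gap : ∀ b k → sameParity (suc b ℕ.+ 2 ℕ.* k) b ≡ false
    even-gap b k = trans (cong (λ m → sameParity (suc b ℕ.+ m) b) (ℕ.*-comm 2 k)) (trans (sameParity-+-*2 (suc b) k b) (sameParity-suc b))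

    odd-gap : ∀ b k → sameParity (suc b ℕ.+ (2 ℕ.* k ℕ.+ 1)) b ≡ true
    odd-gap b k = trans (cong (λ m → sameParity m b) (regroup b k)) (trans (sameParity-+-*2 b (k ℕ.+ 1) b) (sameParity-refl b))
      where
      regroup : ∀ b k → suc b ℕ.+ (2 ℕ.* k ℕ.+ 1) ≡ b ℕ.+ (k ℕ.+ 1) ℕ.* 2
      regroup = ℕ-Ring.solve-∀

  sameParityAbove-reindexed : sameParityAbove ≡ sumTo³ n (λ ρ b k → oddSol ρ (suc b ℕ.+ (2 ℕ.* k ℕ.+ 1)) b)
  sameParityAbove-reindexed = trans (sumTo³-comm₂₃ n _) (sumTo-cong n (λ ρ _ → sumTo-cong n (λ b _ → inner ρ b)))
    where
    G : ℕ → ℕ → ℕ → ℤ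
    G ρ a b = oddSol ρ a b * 𝕀 (sameParity a b)
    inner : ∀ ρ b → sumTo n (λ a → 𝕀 (does (b ℕ.<? a)) * G ρ a b) ≡ sumTo n (λ k → oddSol ρ (suc b ℕ.+ (2 ℕ.* k ℕ.+ 1)) b)
    inner ρ b = begin
      sumTo n (λ a → 𝕀 (does (b ℕ.<? a)) * G ρ a b)
        ≡⟨ sumTo-above n b (λ a → G ρ a b) (λ a n≤a → cong (_* 𝕀 (sameParity a b)) (oddSol-above ρ a b n≤a)) ⟩
      sumTo n (λ d → G ρ (suc b ℕ.+ d) b)
        ≡⟨ sumTo-parity-≥ n _ (λ d n≤d →
             cong (_* 𝕀 (sameParity (suc b ℕ.+ d) b)) (oddSol-above ρ _ b (ℕ.≤-trans n≤d (ℕ.m≤n+m d (suc b))))) ⟩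
      sumTo n (λ k → G ρ (suc b ℕ.+ 2 ℕ.* k) b) + sumTo n (λ k → G ρ (suc b ℕ.+ (2 ℕ.* k ℕ.+ 1)) b)
        ≡⟨ cong₂ _+_ (sumTo-≡0 n (λ k _ → trans (cong (λ c → oddSol ρ (suc b ℕ.+ 2 ℕ.* k) b * 𝕀 c) (even-gap b k))
                                                   (ℤ.*-zeroʳ (oddSol ρ (suc b ℕ.+ 2 ℕ.* k) b))))
                     (sumTo-cong n (λ k _ → trans (cong (λ c → oddSol ρ (suc b ℕ.+ (2 ℕ.* k ℕ.+ 1)) b * 𝕀 c) (odd-gap b k))
                                                  (ℤ.*-identityʳ (oddSol ρ (suc b ℕ.+ (2 ℕ.* k ℕ.+ 1)) b)))) ⟩
      + 0 + sumTo n (λ k → oddSol ρ (suc b ℕ.+ (2 ℕ.* k ℕ.+ 1)) b)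
        ≡⟨ ℤ.+-identityˡ _ ⟩
      sumTo n (λ k → oddSol ρ (suc b ℕ.+ (2 ℕ.* k ℕ.+ 1)) b) ∎

  evenBelow-reindexed : evenBelow ≡ sumTo³ n (λ e a k → evenSol e a (suc a ℕ.+ 2 ℕ.* k))
  evenBelow-reindexed = sumTo-cong n (λ e _ → sumTo-cong n (λ a _ → inner e a))
    where
    inner : ∀ e a → sumTo n (λ b → 𝕀 (does (a ℕ.<? b)) * evenSol e a b) ≡ sumTo n (λ k → evenSol e a (suc a ℕ.+ 2 ℕ.* k))
    inner e a = begin
      sumTo n (λ b → 𝕀 (does (a ℕ.<? b)) * evenSol e a b)
        ≡⟨ sumTo-above n a (evenSol e a) (evenSol-above e a) ⟩
      sumTo n (λ d → evenSol e a (suc a ℕ.+ d))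
        ≡⟨ sumTo-parity-≥ n _ (λ d n≤d → evenSol-above e a _ (ℕ.≤-trans n≤d (ℕ.m≤n+m d (suc a)))) ⟩
      sumTo n (λ k → evenSol e a (suc a ℕ.+ 2 ℕ.* k)) + sumTo n (λ k → evenSol e a (suc a ℕ.+ (2 ℕ.* k ℕ.+ 1)))
        ≡⟨ cong (λ x → sumTo n (λ k → evenSol e a (suc a ℕ.+ 2 ℕ.* k)) + x) (sumTo-≡0 n (λ k _ → same-parity-vanishes k)) ⟩
      sumTo n (λ k → evenSol e a (suc a ℕ.+ 2 ℕ.* k)) + + 0
        ≡⟨ ℤ.+-identityʳ _ ⟩
      sumTo n (λ k → evenSol e a (suc a ℕ.+ 2 ℕ.* k)) ∎
      where
      same-parity-vanishes : ∀ k → evenSol e a (suc a ℕ.+ (2 ℕ.* k ℕ.+ 1)) ≡ + 0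
      same-parity-vanishes k = hits≡0 (e₂ (even⁺ e) (odd a) (odd b)) (λ e₂≡n →
        true≢false (trans (sym (trans (sameParity-sym a b) (odd-gap a k))) (even-e₂≡7 e a b (≡n⇒%8≡7 e₂≡n))))
        where
        b : ℕ
        b = suc a ℕ.+ (2 ℕ.* k ℕ.+ 1)

  -- The substitution (x, y, z) ↦ ((y - z)/2, z, z + 2x) preserves e₂.
  sameParityAbove≡evenBelow : sameParityAbove ≡ evenBelow
  sameParityAbove≡evenBelow = begin
    sameParityAbove                                             ≡⟨ sameParityAbove-reindexed ⟩
    sumTo³ n (λ ρ b k → oddSol ρ (suc b ℕ.+ (2 ℕ.* k ℕ.+ 1)) b) ≡⟨ sumTo³-cong n (λ ρ b k _ _ _ → cong hits (substitution ρ b k)) ⟩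
    sumTo³ n (λ ρ b k → H k b ρ)                                ≡⟨ sumTo³-comm₁₂ n (λ x y z → H z y x) ⟩
    sumTo³ n (λ x y z → H z x y)                                ≡⟨ sumTo³-comm₂₃ n (λ x y z → H z x y) ⟩
    sumTo³ n (λ x y z → H y x z)                                ≡⟨ sumTo³-comm₁₂ n (λ x y z → H y x z) ⟩
    sumTo³ n H                                                  ≡⟨ evenBelow-reindexed ⟨
    evenBelow                                                   ∎
    where
    H : ℕ → ℕ → ℕ → ℤ
    H e a k = evenSol e a (suc a ℕ.+ 2 ℕ.* k)
    identity : ∀ ρ b k →
      (2 ℕ.* ρ ℕ.+ 1) ℕ.* (2 ℕ.* (suc b ℕ.+ (2 ℕ.* k ℕ.+ 1)) ℕ.+ 1) ℕ.+ (2 ℕ.* (suc b ℕ.+ (2 ℕ.* k ℕ.+ 1)) ℕ.+ 1) ℕ.* (2 ℕ.* b ℕ.+ 1)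
        ℕ.+ (2 ℕ.* b ℕ.+ 1) ℕ.* (2 ℕ.* ρ ℕ.+ 1)
      ≡ (2 ℕ.* k ℕ.+ 2) ℕ.* (2 ℕ.* b ℕ.+ 1) ℕ.+ (2 ℕ.* b ℕ.+ 1) ℕ.* (2 ℕ.* (suc b ℕ.+ 2 ℕ.* ρ) ℕ.+ 1)
        ℕ.+ (2 ℕ.* (suc b ℕ.+ 2 ℕ.* ρ) ℕ.+ 1) ℕ.* (2 ℕ.* k ℕ.+ 2)
    identity = ℕ-Ring.solve-∀
    substitution : ∀ ρ b k → e₂ (odd ρ) (odd (suc b ℕ.+ (2 ℕ.* k ℕ.+ 1))) (odd b) ≡ e₂ (even⁺ k) (odd b) (odd (suc b ℕ.+ 2 ℕ.* ρ))
    substitution = identity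

  tripleSum≡diagonalCount : tripleSum n ≡ diagonalCount
  tripleSum≡diagonalCount = begin
    tripleSum n                                                               ≡⟨ tripleSum≡signedCounts ⟩
    sumTo n (λ r → signedCount (suc r))                                       ≡⟨ signedCounts-by-parity ⟩
    sumTo n (λ ρ → signedCount (odd ρ)) + sumTo n (λ e → signedCount (even⁺ e)) ≡⟨ cong₂ _+_ oddSignedCount evenSignedCount ⟩
    sameParityCount - evenCount                                               ≡⟨ cong₂ _-_ sameParityCount-split evenCount-split ⟩
    diagonalCount + (sameParityAbove + sameParityAbove) - (evenBelow + evenBelow)
      ≡⟨ cong (λ x → diagonalCount + (x + x) - (evenBelow + evenBelow)) sameParityAbove≡evenBelow ⟩
    diagonalCount + (evenBelow + evenBelow) - (evenBelow + evenBelow)         ≡⟨ cancel diagonalCount evenBelow ⟩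
    diagonalCount                                                             ∎
    where
    cancel : ∀ d x → d + (x + x) - (x + x) ≡ d
    cancel = ℤ-Ring.solve-∀

  private
    n-odd : n % 2 ≡ 1
    n-odd = begin
      n % 2                           ≡⟨ cong (_% 2) (m≡m%n+[m/n]*n n 8) ⟩
      (n % 8 ℕ.+ (n / 8) ℕ.* 8) % 2   ≡⟨ cong (λ r → (r ℕ.+ (n / 8) ℕ.* 8) % 2) n≡7 ⟩
      (7 ℕ.+ (n / 8) ℕ.* 8) % 2       ≡⟨ cong (λ m → (7 ℕ.+ m) % 2) (sym (ℕ.*-assoc (n / 8) 4 2)) ⟩
      (7 ℕ.+ (n / 8) ℕ.* 4 ℕ.* 2) % 2 ≡⟨ [m+kn]%n≡m%n 7 ((n / 8) ℕ.* 4) 2 ⟩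
      1                               ∎

    hits-even : ∀ X → hits (X ℕ.* 2) ≡ + 0
    hits-even X = hits≡0 (X ℕ.* 2) (λ 2X≡n → ℕ.0≢1+n (trans (sym (m*n%n≡0 X 2)) (trans (cong (_% 2) 2X≡n) n-odd)))

    hits-square : ∀ d → hits (d ℕ.* d) ≡ + 0
    hits-square d = hits≡0 (d ℕ.* d) (λ d²≡n → true≢false (trans (sym (ResiduesMod8.square-residue d))
                                                             (cong ResiduesMod8.x²-residue (≡n⇒%8≡7 d²≡n))))

  divisorPairs : ℕ → ℕ → ℤ
  divisorPairs d w = hits (suc d ℕ.* suc w)

  private
    divisorPairs-above : ∀ d w → n ≤ w → divisorPairs d w ≡ + 0
    divisorPairs-above d w n≤w = hits->n (ℕ.<-≤-trans (s≤s n≤w) (ℕ.m≤n*m (suc w) (suc d)))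

    divisorPairs-above′ : ∀ d w → n ≤ d → divisorPairs d w ≡ + 0
    divisorPairs-above′ d w n≤d = hits->n (ℕ.<-≤-trans (s≤s n≤d) (ℕ.m≤m*n (suc d) (suc w)))

  divisor-indicator : ∀ d → sumTo n (divisorPairs d) ≡ 𝕀 (does (suc d ∣? n))
  divisor-indicator d with suc d ∣? n
  ... | yes d∣n = trans (divisor d∣n) (cong 𝕀 (sym (dec-true (suc d ∣? n) d∣n)))
    where
    divisor : suc d ∣ n → sumTo n (divisorPairs d) ≡ + 1
    divisor (divides zero    n≡0)  = ⊥-elim (ℕ.0≢1+n (trans (sym (cong (_% 2) n≡0)) n-odd))
    divisor (divides (suc q) n≡qd) = begin
      sumTo n (divisorPairs d)
        ≡⟨ sumTo-cong n (λ w _ → trans (cong 𝕀 (does-⇔ (mk⇔ cancel (λ { refl → sym n≡dq })) (suc d ℕ.* suc w ℕ.≟ n) (w ℕ.≟ q)))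
                                       (sym (ℤ.*-identityʳ (δ q w)))) ⟩
      sumTo n (λ w → δ q w * + 1)
        ≡⟨ sumTo-δ n q (λ _ → + 1) q<n ⟩
      + 1 ∎
      where
      n≡dq : n ≡ suc d ℕ.* suc q
      n≡dq = trans n≡qd (ℕ.*-comm (suc q) (suc d))
      cancel : ∀ {w} → suc d ℕ.* suc w ≡ n → w ≡ q
      cancel p = ℕ.suc-injective (ℕ.*-cancelˡ-≡ _ _ (suc d) (trans p n≡dq))
      q<n : q < n
      q<n = ≡.subst (q <_) (sym n≡dq) (ℕ.m≤n*m (suc q) (suc d))
  ... | no  d∤n = trans (sumTo-≡0 n (λ w _ → hits≡0 _ (λ p → d∤n (divides (suc w) (trans (sym p) (ℕ.*-comm (suc d) (suc w)))))))
                        (cong 𝕀 (sym (dec-false (suc d ∣? n) d∤n)))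

  private
    length-filter : ∀ m (f : ℕ → ℕ) →
      + length (filter (_∣? n) (map suc (applyUpTo f m))) ≡ sumTo m (λ i → 𝕀 (does (suc (f i) ∣? n)))
    length-filter zero    f = refl
    length-filter (suc m) f with does (suc (f 0) ∣? n) in d∣?n
    ... | true  = trans (cong (λ x → + 1 + x) (length-filter m (f ∘ suc)))
                        (sym (trans (sumTo-unfoldˡ m _) (cong (λ c → 𝕀 c + sumTo m (λ i → 𝕀 (does (suc (f (suc i)) ∣? n)))) d∣?n)))
    ... | false = trans (length-filter m (f ∘ suc))
                        (sym (trans (sumTo-unfoldˡ m _) (trans (cong (λ c → 𝕀 c + sumTo m (λ i → 𝕀 (does (suc (f (suc i)) ∣? n)))) d∣?n)
                                                                (ℤ.+-identityˡ _))))

  σ₀≡divisorPairs : + σ₀ n ≡ sumTo² n divisorPairs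
  σ₀≡divisorPairs = trans (length-filter n id) (sumTo-cong n (λ d _ → sym (divisor-indicator d)))

  divisorPairsBelow : ℤ
  divisorPairsBelow = sumTo² n (λ d w → 𝕀 (does (d ℕ.<? w)) * divisorPairs d w)

  divisorPairs-split : sumTo² n divisorPairs ≡ divisorPairsBelow + divisorPairsBelow
  divisorPairs-split = begin
    sumTo² n divisorPairs                                                ≡⟨ sumTo²-trichotomy n divisorPairs ⟩
    sumTo² n (λ d w → 𝕀 (does (w ℕ.<? d)) * divisorPairs d w) + sumTo n (λ d → divisorPairs d d) + divisorPairsBelow
                                                                         ≡⟨ cong₂ (λ u v → u + v + divisorPairsBelow) above diagonal ⟩
    divisorPairsBelow + + 0 + divisorPairsBelow                          ≡⟨ cong (_+ divisorPairsBelow) (ℤ.+-identityʳ divisorPairsBelow) ⟩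
    divisorPairsBelow + divisorPairsBelow                                ∎
    where
    above : sumTo² n (λ d w → 𝕀 (does (w ℕ.<? d)) * divisorPairs d w) ≡ divisorPairsBelow
    above = trans (sumTo²-comm n _) (sumTo²-cong n (λ d w _ _ → cong (λ m → 𝕀 (does (d ℕ.<? w)) * hits m) (ℕ.*-comm (suc w) (suc d))))
    diagonal : sumTo n (λ d → divisorPairs d d) ≡ + 0
    diagonal = sumTo-≡0 n (λ d _ → hits-square (suc d))

  private
    even-divisor : ∀ a w → divisorPairs (2 ℕ.* a ℕ.+ 1) w ≡ + 0
    even-divisor a w = trans (cong hits (even-product a w)) (hits-even (suc w ℕ.* (a ℕ.+ 1)))
      where
      even-product : ∀ a w → suc (2 ℕ.* a ℕ.+ 1) ℕ.* suc w ≡ (suc w ℕ.* (a ℕ.+ 1)) ℕ.* 2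
      even-product = ℕ-Ring.solve-∀

    -- For odd d, the cofactor w = d + 2x with x odd gives d · w = e₂ x d d; x even is excluded mod 8.
    odd-divisor : ∀ a → sumTo n (λ j → divisorPairs (2 ℕ.* a) (suc (2 ℕ.* a) ℕ.+ j)) ≡ sumTo n (λ ρ → oddSol ρ a a)
    odd-divisor a = begin
      sumTo n (λ j → divisorPairs d (suc d ℕ.+ j))
        ≡⟨ sumTo-parity-≥ n _ (λ j n≤j → divisorPairs-above d (suc d ℕ.+ j) (ℕ.≤-trans n≤j (ℕ.m≤n+m j (suc d)))) ⟩
      sumTo n (λ i → divisorPairs d (suc d ℕ.+ 2 ℕ.* i)) + sumTo n (λ i → divisorPairs d (suc d ℕ.+ (2 ℕ.* i ℕ.+ 1)))
        ≡⟨ cong₂ _+_ (sumTo-≡0 n (λ i _ → trans (cong hits (even-cofactor a i)) (hits-even (suc d ℕ.* (a ℕ.+ i ℕ.+ 1)))))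
                     (sumTo-parity-≥ n _ (λ i n≤i → divisorPairs-above d _ (ℕ.≤-trans n≤i (i≤w i)))) ⟩
      + 0 + (sumTo n (λ ρ → divisorPairs d (suc d ℕ.+ (2 ℕ.* (2 ℕ.* ρ) ℕ.+ 1)))
             + sumTo n (λ ρ → divisorPairs d (suc d ℕ.+ (2 ℕ.* (2 ℕ.* ρ ℕ.+ 1) ℕ.+ 1))))
        ≡⟨ trans (ℤ.+-identityˡ _) (cong₂ _+_ (sumTo-cong n (λ ρ _ → cong hits (gap-1-mod-4 a ρ)))
                                               (sumTo-≡0 n (λ ρ _ → trans (cong hits (gap-3-mod-4 a ρ)) (evenSol-diagonal ρ a)))) ⟩
      sumTo n (λ ρ → oddSol ρ a a) + + 0
        ≡⟨ ℤ.+-identityʳ _ ⟩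
      sumTo n (λ ρ → oddSol ρ a a) ∎
      where
      d : ℕ
      d = 2 ℕ.* a
      i≤w : ∀ i → i ≤ suc d ℕ.+ (2 ℕ.* i ℕ.+ 1)
      i≤w i = ℕ.≤-trans (ℕ.m≤m+n i (i ℕ.+ 0)) (ℕ.≤-trans (ℕ.m≤m+n (2 ℕ.* i) 1) (ℕ.m≤n+m (2 ℕ.* i ℕ.+ 1) (suc d)))
      even-cofactor : ∀ a i → suc (2 ℕ.* a) ℕ.* suc (suc (2 ℕ.* a) ℕ.+ 2 ℕ.* i) ≡ (suc (2 ℕ.* a) ℕ.* (a ℕ.+ i ℕ.+ 1)) ℕ.* 2
      even-cofactor = ℕ-Ring.solve-∀
      gap-1-mod-4 : ∀ a ρ → suc (2 ℕ.* a) ℕ.* suc (suc (2 ℕ.* a) ℕ.+ (2 ℕ.* (2 ℕ.* ρ) ℕ.+ 1))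
        ≡ (2 ℕ.* ρ ℕ.+ 1) ℕ.* (2 ℕ.* a ℕ.+ 1) ℕ.+ (2 ℕ.* a ℕ.+ 1) ℕ.* (2 ℕ.* a ℕ.+ 1) ℕ.+ (2 ℕ.* a ℕ.+ 1) ℕ.* (2 ℕ.* ρ ℕ.+ 1)
      gap-1-mod-4 = ℕ-Ring.solve-∀
      gap-3-mod-4 : ∀ a ρ → suc (2 ℕ.* a) ℕ.* suc (suc (2 ℕ.* a) ℕ.+ (2 ℕ.* (2 ℕ.* ρ ℕ.+ 1) ℕ.+ 1))
        ≡ (2 ℕ.* ρ ℕ.+ 2) ℕ.* (2 ℕ.* a ℕ.+ 1) ℕ.+ (2 ℕ.* a ℕ.+ 1) ℕ.* (2 ℕ.* a ℕ.+ 1) ℕ.+ (2 ℕ.* a ℕ.+ 1) ℕ.* (2 ℕ.* ρ ℕ.+ 2)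
      gap-3-mod-4 = ℕ-Ring.solve-∀

  divisorPairsBelow≡diagonalCount : divisorPairsBelow ≡ diagonalCount
  divisorPairsBelow≡diagonalCount = begin
    divisorPairsBelow
      ≡⟨ sumTo-cong n (λ d _ → sumTo-above n d (divisorPairs d) (divisorPairs-above d)) ⟩
    sumTo n R
      ≡⟨ sumTo-parity-≥ n R (λ d n≤d → sumTo-≡0 n (λ j _ → divisorPairs-above′ d (suc d ℕ.+ j) n≤d)) ⟩
    sumTo n (λ a → R (2 ℕ.* a)) + sumTo n (λ a → R (2 ℕ.* a ℕ.+ 1))
      ≡⟨ cong₂ _+_ (sumTo-cong n (λ a _ → odd-divisor a)) (sumTo-≡0 n (λ a _ → sumTo-≡0 n (λ j _ → even-divisor a _))) ⟩
    sumTo² n (λ a ρ → oddSol ρ a a) + + 0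
      ≡⟨ ℤ.+-identityʳ _ ⟩
    sumTo² n (λ a ρ → oddSol ρ a a)
      ≡⟨ sumTo²-comm n _ ⟩
    diagonalCount ∎
    where
    R : ℕ → ℤ
    R d = sumTo n (λ j → divisorPairs d (suc d ℕ.+ j))

  σ₀≡2diagonalCount : + σ₀ n ≡ diagonalCount + diagonalCount
  σ₀≡2diagonalCount =
    trans σ₀≡divisorPairs (trans divisorPairs-split (cong₂ _+_ divisorPairsBelow≡diagonalCount divisorPairsBelow≡diagonalCount))


open import Data.Integer using (+_; _+_; _*_; _-_)
open import Data.Product using (_×_; _,_)

proposition5p4 : (n : ℕ) → n % 8 ≡ 7 →
    (a n ≡ + 2 * + σ₀ n - + 4 * tripleSum n) × (+ 2 * + σ₀ n - + 4 * tripleSum n ≡ + 0)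
proposition5p4 n n≡7 = ≡.trans (ResiduesMod8.a≡0 n n≡7) (≡.sym combination≡0) , combination≡0
  where
  open SolutionCounts n n≡7
  open ≡.≡-Reasoning
  2[d+d]-4d≡0 : ∀ d → + 2 * (d + d) - + 4 * d ≡ + 0
  2[d+d]-4d≡0 = ℤ-Ring.solve-∀
  combination≡0 : + 2 * + σ₀ n - + 4 * tripleSum n ≡ + 0
  combination≡0 = begin
    + 2 * + σ₀ n - + 4 * tripleSum n                          ≡⟨ ≡.cong₂ (λ s t → + 2 * s - + 4 * t) σ₀≡2diagonalCount tripleSum≡diagonalCount ⟩
    + 2 * (diagonalCount + diagonalCount) - + 4 * diagonalCount ≡⟨ 2[d+d]-4d≡0 diagonalCount ⟩
    + 0                                                       ∎
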